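{- Let $i,j,k$ be nonnegative integers with $i+j+k\ge1$, and let $$P(z)=\prod\big(1-z^{n_1\cdots n_i d_1\cdots d_j e_1\cdots e_k}\big)^{ -n_1\cdots n_i/(d_1\cdots d_j)},$$ the product taken over all $(i+j+k)$-tuples $(n_1,\dots,n_i,d_1,\dots,d_j,e_1,\dots,e_k)$ of positive integers (empty products of indices equal $1$), regarded as a formal power series in $z$. For every positive integer $n$, write the divisors of $n$ as $1=p_1<\dots<p_{\tau(n)}=n$, and for a divisor $p_\ell$ of $n$ write the divisors of $n/p_\ell$ as $q_1<\dots<q_{\tau(n/p_\ell)}$. Define $$\chi(n)=\begin{cases} n^2\,\tau_i(n) & \text{if } i\ge1,\ j=0,\ k=0,\\ n\sum_{\ell=1}^{\tau(n)}p_\ell\,\tau_i(p_\ell)\,\tau_k(n/p_\ell) & \text{if } i\ge1,\ j=0,\ k\ge1,\\ \sum_{\ell=1}^{\tau(n)}p_\ell^2\,\tau_i(p_\ell)\,\tau_j(n/p_\ell) & \text{if } i\ge1,\ j\ge1,\ k=0,\\ \sum_{\ell=1}^{\tau(n)}\sum_{m=1}^{\tau(n/p_\ell)}p_\ell^2\,q_m\,\tau_i(p_\ell)\,\tau_k(q_m)\,\tau_j\big(n/(p_\ell q_m)\big) & \text{if } i\ge1,\ j\ge1,\ k\ge1,\\ n\,\tau_k(n) & \text{if } i=0,\ j=0,\ k\ge1,\\ \sum_{\ell=1}^{\tau(n)}p_\ell\,\tau_k(p_\ell)\,\tau_j(n/p_\ell) & \text{if } i=0,\ j\ge1,\ k\ge1,\\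 \tau_j(n) & \text{if } i=0,\ j\ge1,\ k=0. \end{cases}$$ Then $$P(z)=\prod_{n\ge1}\exp\Big(\sum_{\ell=1}^{\infty}\frac{z^{n\ell}}{n\ell}\Big)^{\chi(n)}.$$
   Context: For $m\ge1$, $\tau_m(n)$ denotes the number of ordered $m$-tuples $(a_1,\dots,a_m)$ of positive integers with $a_1\cdots a_m=n$; in particular $\tau_1(n)=1$, and $\tau(n)=\tau_2(n)$ is the number of positive divisors of $n$. -}

module Defs where

open import Data.Nat as ℕ using (ℕ; zero; suc; _≤_; _≤?_; _≟_)
open import Data.Nat.Divisibility using (_∣?_)

open import Data.Integer as ℤ using (ℤ; +_)
open import Data.Rational as ℚ using (ℚ; 0ℚ; 1ℚ; _+_; _*_; -_; _-_)
open import Data.List as L using (List; []; _∷_; map; filter; length; concatMap; upTo; take; drop; foldr)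
open import Data.Product using (_×_; _,_)
open import Relation.Nullary.Decidable using (does)
open import Data.Bool using (if_then_else_)

range : ℕ → List ℕ
range N = map suc (upTo N)

prodℕ : List ℕ → ℕ
prodℕ = foldr ℕ._*_ 1

sumℕ : List ℕ → ℕ
sumℕ = foldr ℕ._+_ 0

sumℚ : List ℚ → ℚ
sumℚ = foldr _+_ 0ℚ

prodℚ : List ℚ → ℚ
prodℚ = foldr _*_ 1ℚ

tuples : ℕ → ℕ → List (List ℕ)
tuples zero    N = [] ∷ []
tuples (suc m) N = concatMap (λ a → map (a ∷_) (tuples m N)) (range N)

-- τ_m(n): number of ordered m-tuples of positive integers with product n
-- (each entry of such a tuple is ≤ n, so enumerating [1..n]^m is exhaustive)
τ : ℕ → ℕ → ℕ
τ m n = length (filter (λ t → prodℕ t ≟ n) (tuples m n))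

-- ordered factorisations n = a·b  (a runs over the divisors p of n, b = n/p)
pairs : ℕ → List (ℕ × ℕ)
pairs n = filter (λ { (a , b) → a ℕ.* b ≟ n })
                 (concatMap (λ a → map (a ,_) (range n)) (range n))

-- ordered factorisations n = a·b·c  (a = p_ℓ, b = q_m | n/p_ℓ, c = n/(p_ℓ q_m))
triples : ℕ → List (ℕ × ℕ × ℕ)
triples n = filter (λ { (a , b , c) → a ℕ.* b ℕ.* c ≟ n })
  (concatMap (λ a → concatMap (λ b → map (λ c → (a , b , c)) (range n)) (range n)) (range n))

-- χ(n), by cases on whether i, j, k are zero (case i=j=k=0 is excluded by hypothesis)
χ : ℕ → ℕ → ℕ → ℕ → ℕ
χ zero    zero    zero    n = 0
χ i@(suc _) zero zero     n = n ℕ.* n ℕ.* τ i n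
χ i@(suc _) zero k@(suc _) n =
  n ℕ.* sumℕ (map (λ { (p , q) → p ℕ.* τ i p ℕ.* τ k q }) (pairs n))
χ i@(suc _) j@(suc _) zero n =
  sumℕ (map (λ { (p , q) → p ℕ.* p ℕ.* τ i p ℕ.* τ j q }) (pairs n))
χ i@(suc _) j@(suc _) k@(suc _) n =
  sumℕ (map (λ { (p , q , r) → p ℕ.* p ℕ.* q ℕ.* τ i p ℕ.* τ k q ℕ.* τ j r }) (triples n))
χ zero zero k@(suc _) n = n ℕ.* τ k n
χ zero j@(suc _) k@(suc _) n =
  sumℕ (map (λ { (p , q) → p ℕ.* τ k p ℕ.* τ j q }) (pairs n))
χ zero j@(suc _) zero n = τ j n

PS : Set
PS = ℕ → ℚ

fromℕ : ℕ → ℚ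
fromℕ n = + n ℚ./ 1

-- 1/n (only used for n ≥ 1)
inv : ℕ → ℚ
inv zero    = 0ℚ
inv (suc n) = + 1 ℚ./ suc n

-- a/b (only used for b ≥ 1)
frac : ℕ → ℕ → ℚ
frac a zero    = 0ℚ
frac a (suc b) = + a ℚ./ suc b

oneS : PS
oneS zero    = 1ℚ
oneS (suc _) = 0ℚ

_⊛_ : PS → PS → PS
(f ⊛ g) N = sumℚ (map (λ a → f a * g (N ℕ.∸ a)) (L.upTo (suc N)))

prodS : List PS → PS
prodS = foldr _⊛_ oneS

powS : PS → ℕ → PS
powS f zero    = oneS
powS f (suc k) = f ⊛ powS f k

-- exp f = Σ_k f^k / k!, for f with zero constant term
-- (then f^k has no terms below z^k, so the coefficient of z^N only needs k ≤ N)
expS : PS → PS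
expS f N = sumℚ (map (λ k → powS f k N * inv (k ℕ.!)) (L.upTo (suc N)))

-- generalized binomial coefficient (-1)^k * binom(s , k) = ∏_{t<k} (t - s)/(t+1)
negBinom : ℚ → ℕ → ℚ
negBinom s k = prodℚ (map (λ t → (fromℕ t - s) * inv (suc t)) (L.upTo k))

-- (1 - z^m)^s = Σ_k (-1)^k binom(s,k) z^{mk}, for m ≥ 1 and rational s
binomS : ℕ → ℚ → PS
binomS m s N = sumℚ (map (λ k → if does (m ℕ.* k ≟ N) then negBinom s k else 0ℚ)
                         (L.upTo (suc N)))

-- The factor of a tuple with exponent-product m is 1 + O(z^m); so the coefficient
-- of z^N of the (formally convergent) infinite product is the coefficient of z^N
-- of the finite product over the tuples whose product is ≤ N.

factorP : ℕ → ℕ → List ℕ → PS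
factorP i j t = binomS (prodℕ t) (- frac (prodℕ (take i t)) (prodℕ (take j (drop i t))))

P : ℕ → ℕ → ℕ → PS
P i j k N = prodS (map (factorP i j)
                       (filter (λ t → prodℕ t ≤? N) (tuples (i ℕ.+ j ℕ.+ k) N))) N

-- Right side: ∏_{n ≥ 1} exp(Σ_{ℓ≥1} z^{nℓ}/(nℓ))^{χ(n)}.
-- The n-th factor is 1 + O(z^n), so coefficient N only needs n ≤ N.

-- Σ_{ℓ ≥ 1} z^{nℓ}/(nℓ)   (n ≥ 1)
logS : ℕ → PS
logS n zero    = 0ℚ
logS n (suc M) = if does (n ∣? suc M) then inv (suc M) else 0ℚ

R : ℕ → ℕ → ℕ → PS
R i j k N = prodS (map (λ n → powS (expS (logS n)) (χ i j k n)) (range N)) N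

-- Both sides are compared through their logarithmic derivatives z F′/F, since a power series with
-- constant term 1 is determined by its logarithmic derivative. The factor of P for a tuple with
-- product m contributes m n₁⋯nᵢ/(d₁⋯dⱼ) (z^m + z^{2m} + ⋯). Writing p, r, q for the products of the
-- n-, d- and e-blocks of the tuple, this weight is p² q, so the tuples with product n contribute in
-- total Σ_{n = p r q} τᵢ(p) τⱼ(r) τₖ(q) p² q, which is χ(n) in each of the seven cases because τ₀ is
-- the indicator of 1. The n-th factor of R contributes χ(n) (z^n + z^{2n} + ⋯) as well.

module Submission where

open import Defs
open import Data.Bool using (Bool; true; false; if_then_else_)
open import Data.Empty using (⊥-elim)
import Data.Integer as ℤ
import Data.Integer.Properties as ℤP
open import Data.List using (List; []; _∷_; _++_; map; filter; concatMap; upTo; applyUpTo; length; take; drop)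
import Data.List.Properties as ListP
open import Data.List.Relation.Unary.All as All using (All; []; _∷_)
import Data.List.Relation.Unary.All.Properties as AllP
open import Data.Nat as ℕ using (ℕ; zero; suc; _∸_; z≤n; s≤s; _≤_; _<_; _≟_; _≤?_; _!)
import Data.Nat.Properties as ℕP
open import Data.Nat.Tactic.RingSolver using (solve-∀)
import Data.Nat.Coprimality as Coprime
open import Data.Nat.Divisibility as ∣ using (_∣_; _∣?_; divides)
open import Data.Product using (_×_; _,_)
open import Data.Rational using (ℚ; mkℚ; 0ℚ; 1ℚ; _+_; _*_; -_; _-_)
import Data.Rational.Properties as ℚP
open import Data.Rational.Solver using (module +-*-Solver)
open import Data.Sum using (inj₁; inj₂)
open import Function using (_∘_)
open import Level using (0ℓ)
open import Relation.Binary.PropositionalEquality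
open import Relation.Nullary using (¬_; Dec; yes; no)
open import Relation.Nullary.Decidable using (does)
open import Relation.Unary using (Pred; Decidable)

open +-*-Solver using (solve; _:+_; _:*_; :-_; _:-_; _:=_; con)

private variable
  X Y : Set


-- Natural numbers inside ℚ

fromℕ≡mkℚ : ∀ n → fromℕ n ≡ mkℚ (ℤ.+ n) 0 (Coprime.sym (Coprime.1-coprimeTo n))
fromℕ≡mkℚ n = ℚP.↥p/↧p≡p _

inv≡mkℚ : ∀ n → inv (suc n) ≡ mkℚ (ℤ.+ 1) n (Coprime.1-coprimeTo (suc n))
inv≡mkℚ n = ℚP.↥p/↧p≡p _

fromℕ-+ : ∀ a b → fromℕ (a ℕ.+ b) ≡ fromℕ a + fromℕ b
fromℕ-+ a b = trans
  (ℚP./-cong (trans (ℤP.pos-+ a b) (sym (cong₂ ℤ._+_ (ℤP.*-identityʳ (ℤ.+ a)) (ℤP.*-identityʳ (ℤ.+ b))))) refl)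
  (sym (cong₂ _+_ (fromℕ≡mkℚ a) (fromℕ≡mkℚ b)))

fromℕ-* : ∀ a b → fromℕ (a ℕ.* b) ≡ fromℕ a * fromℕ b
fromℕ-* a b = trans (ℚP./-cong (ℤP.pos-* a b) refl) (sym (cong₂ _*_ (fromℕ≡mkℚ a) (fromℕ≡mkℚ b)))

inv*fromℕ≡1 : ∀ n → inv (suc n) * fromℕ (suc n) ≡ 1ℚ
inv*fromℕ≡1 n rewrite inv≡mkℚ n | fromℕ≡mkℚ (suc n) =
  ℚP.*-inverseˡ (mkℚ (ℤ.+ suc n) 0 (Coprime.sym (Coprime.1-coprimeTo (suc n))))

fromℕ*inv≡1 : ∀ n → fromℕ (suc n) * inv (suc n) ≡ 1ℚ
fromℕ*inv≡1 n = trans (ℚP.*-comm (fromℕ (suc n)) (inv (suc n))) (inv*fromℕ≡1 n)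

fromℕ-*-cancelˡ : ∀ n {x y} → fromℕ (suc n) * x ≡ fromℕ (suc n) * y → x ≡ y
fromℕ-*-cancelˡ n {x} {y} e = begin
  x                                 ≡⟨ sym (ℚP.*-identityˡ x) ⟩
  1ℚ * x                            ≡⟨ cong (_* x) (sym (inv*fromℕ≡1 n)) ⟩
  inv (suc n) * fromℕ (suc n) * x   ≡⟨ ℚP.*-assoc (inv (suc n)) _ x ⟩
  inv (suc n) * (fromℕ (suc n) * x) ≡⟨ cong (inv (suc n) *_) e ⟩
  inv (suc n) * (fromℕ (suc n) * y) ≡⟨ sym (ℚP.*-assoc (inv (suc n)) _ y) ⟩
  inv (suc n) * fromℕ (suc n) * y   ≡⟨ cong (_* y) (inv*fromℕ≡1 n) ⟩
  1ℚ * y                            ≡⟨ ℚP.*-identityˡ y ⟩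
  y                                 ∎
  where open ≡-Reasoning

frac≡fromℕ*inv : ∀ a b → frac a (suc b) ≡ fromℕ a * inv (suc b)
frac≡fromℕ*inv a b = trans
  (ℚP./-cong (sym (ℤP.*-identityʳ (ℤ.+ a))) (sym (ℕP.*-identityˡ (suc b))))
  (sym (cong₂ _*_ (fromℕ≡mkℚ a) (inv≡mkℚ b)))

inv-* : ∀ a b → inv (suc a ℕ.* suc b) ≡ inv (suc a) * inv (suc b)
inv-* a b = fromℕ-*-cancelˡ (b ℕ.+ a ℕ.* suc b) (trans (fromℕ*inv≡1 (b ℕ.+ a ℕ.* suc b)) (sym (begin
  fromℕ (suc a ℕ.* suc b) * (inv (suc a) * inv (suc b))
    ≡⟨ cong (_* (inv (suc a) * inv (suc b))) (fromℕ-* (suc a) (suc b)) ⟩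
  fromℕ (suc a) * fromℕ (suc b) * (inv (suc a) * inv (suc b))
    ≡⟨ regroup (fromℕ (suc a)) (fromℕ (suc b)) (inv (suc a)) (inv (suc b)) ⟩
  fromℕ (suc a) * inv (suc a) * (fromℕ (suc b) * inv (suc b))
    ≡⟨ cong₂ _*_ (fromℕ*inv≡1 a) (fromℕ*inv≡1 b) ⟩
  1ℚ ∎)))
  where
  open ≡-Reasoning
  regroup : ∀ x y u v → x * y * (u * v) ≡ x * u * (y * v)
  regroup = solve 4 (λ x y u v → x :* y :* (u :* v) := x :* u :* (y :* v)) refl

fromℕ*inv-! : ∀ j → fromℕ (suc j) * inv (suc j !) ≡ inv (j !)
fromℕ*inv-! j with j ! | ℕP.1≤n! j
... | suc m | _ = begin
  fromℕ (suc j) * inv (suc j ℕ.* suc m)           ≡⟨ cong (fromℕ (suc j) *_) (inv-* j m) ⟩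
  fromℕ (suc j) * (inv (suc j) * inv (suc m))     ≡⟨ sym (ℚP.*-assoc (fromℕ (suc j)) _ _) ⟩
  fromℕ (suc j) * inv (suc j) * inv (suc m)       ≡⟨ cong (_* inv (suc m)) (fromℕ*inv≡1 j) ⟩
  1ℚ * inv (suc m)                                ≡⟨ ℚP.*-identityˡ _ ⟩
  inv (suc m)                                     ∎
  where open ≡-Reasoning

-- Finite sums

when : Bool → ℚ → ℚ
when b v = if b then v else 0ℚ

when-yes : ∀ {P : Set} (d : Dec P) v → P → when (does d) v ≡ v
when-yes (yes _) v _ = refl
when-yes (no ¬p) v p = ⊥-elim (¬p p)

when-no : ∀ {P : Set} (d : Dec P) v → ¬ P → when (does d) v ≡ 0ℚ
when-no (yes p) v ¬p = ⊥-elim (¬p p)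
when-no (no _)  v _  = refl

when-cong : ∀ {P : Set} (d : Dec P) {v w} → (P → v ≡ w) → when (does d) v ≡ when (does d) w
when-cong (yes p) e = e p
when-cong (no _)  e = refl

when≡*when1 : ∀ b v → when b v ≡ v * when b 1ℚ
when≡*when1 true  v = sym (ℚP.*-identityʳ v)
when≡*when1 false v = sym (ℚP.*-zeroʳ v)

*-when : ∀ c b v → c * when b v ≡ when b (c * v)
*-when c true  v = refl
*-when c false v = ℚP.*-zeroʳ c

when-when : ∀ b c v → when b (when c v) ≡ when c (when b v)
when-when true  c     v = refl
when-when false true  v = refl
when-when false false v = refl

δ : ℕ → ℕ → ℚ → ℚ
δ x n = when (does (x ≟ n))

infix 2 Σl
Σl : List X → (X → ℚ) → ℚ
Σl xs f = sumℚ (map f xs)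
syntax Σl xs (λ x → e) = ∑[ x ∈ xs ] e

Σl-++ : ∀ (xs ys : List X) f → Σl (xs ++ ys) f ≡ Σl xs f + Σl ys f
Σl-++ []       ys f = sym (ℚP.+-identityˡ (Σl ys f))
Σl-++ (x ∷ xs) ys f = trans (cong (f x +_) (Σl-++ xs ys f)) (sym (ℚP.+-assoc (f x) _ _))

Σl-map : ∀ (xs : List X) (g : X → Y) f → Σl (map g xs) f ≡ Σl xs (f ∘ g)
Σl-map []       g f = refl
Σl-map (x ∷ xs) g f = cong (f (g x) +_) (Σl-map xs g f)

Σl-concatMap : ∀ (xs : List X) (g : X → List Y) f →
  Σl (concatMap g xs) f ≡ Σl xs (λ x → Σl (g x) f)
Σl-concatMap []       g f = refl
Σl-concatMap (x ∷ xs) g f =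
  trans (Σl-++ (g x) (concatMap g xs) f) (cong (Σl (g x) f +_) (Σl-concatMap xs g f))

Σl-cong : ∀ (xs : List X) {f g} → (∀ x → f x ≡ g x) → Σl xs f ≡ Σl xs g
Σl-cong []       e = refl
Σl-cong (x ∷ xs) e = cong₂ _+_ (e x) (Σl-cong xs e)

Σl-cong-All : ∀ {P : X → Set} (xs : List X) {f g} → All P xs → (∀ x → P x → f x ≡ g x) →
  Σl xs f ≡ Σl xs g
Σl-cong-All []       []         e = refl
Σl-cong-All (x ∷ xs) (px ∷ pxs) e = cong₂ _+_ (e x px) (Σl-cong-All xs pxs e)

Σl-zero : ∀ (xs : List X) → Σl xs (λ _ → 0ℚ) ≡ 0ℚ
Σl-zero []       = refl
Σl-zero (x ∷ xs) = trans (ℚP.+-identityˡ _) (Σl-zero xs)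

Σl-vanishing-All : ∀ {P : X → Set} (xs : List X) {f} → All P xs → (∀ x → P x → f x ≡ 0ℚ) → Σl xs f ≡ 0ℚ
Σl-vanishing-All xs all f≡0 = trans (Σl-cong-All xs all f≡0) (Σl-zero xs)

Σl-+ : ∀ (xs : List X) f g → Σl xs (λ x → f x + g x) ≡ Σl xs f + Σl xs g
Σl-+ []       f g = refl
Σl-+ (x ∷ xs) f g = trans (cong (f x + g x +_) (Σl-+ xs f g)) (swap (f x) (g x) _ _)
  where
  swap : ∀ a b c d → a + b + (c + d) ≡ a + c + (b + d)
  swap = solve 4 (λ a b c d → a :+ b :+ (c :+ d) := a :+ c :+ (b :+ d)) refl

Σl-*ˡ : ∀ (xs : List X) c f → Σl xs (λ x → c * f x) ≡ c * Σl xs f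
Σl-*ˡ []       c f = sym (ℚP.*-zeroʳ c)
Σl-*ˡ (x ∷ xs) c f = trans (cong (c * f x +_) (Σl-*ˡ xs c f)) (sym (ℚP.*-distribˡ-+ c (f x) _))

Σl-*ʳ : ∀ (xs : List X) c f → Σl xs (λ x → f x * c) ≡ Σl xs f * c
Σl-*ʳ xs c f = trans (Σl-cong xs (λ x → ℚP.*-comm (f x) c)) (trans (Σl-*ˡ xs c f) (ℚP.*-comm c _))

Σl-comm : ∀ (xs : List X) (ys : List Y) (f : X → Y → ℚ) →
  Σl xs (λ x → Σl ys (f x)) ≡ Σl ys (λ y → Σl xs (λ x → f x y))
Σl-comm []       ys f = sym (Σl-zero ys)
Σl-comm (x ∷ xs) ys f =
  trans (cong (Σl ys (f x) +_) (Σl-comm xs ys f)) (sym (Σl-+ ys (f x) (λ y → Σl xs (λ x' → f x' y))))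

Σl-filter : ∀ {P : Pred X 0ℓ} (P? : Decidable P) (xs : List X) f →
  Σl (filter P? xs) f ≡ Σl xs (λ x → when (does (P? x)) (f x))
Σl-filter P? []       f = refl
Σl-filter P? (x ∷ xs) f with does (P? x)
... | true  = cong (f x +_) (Σl-filter P? xs f)
... | false = trans (Σl-filter P? xs f) (sym (ℚP.+-identityˡ _))

Σl-when : ∀ (xs : List X) b f → Σl xs (λ x → when b (f x)) ≡ when b (Σl xs f)
Σl-when xs true  f = refl
Σl-when xs false f = Σl-zero xs

length-filter≡Σl : ∀ {P : Pred X 0ℓ} (P? : Decidable P) xs →
  fromℕ (length (filter P? xs)) ≡ Σl xs (λ x → when (does (P? x)) 1ℚ)
length-filter≡Σl P? []       = refl
length-filter≡Σl P? (x ∷ xs) with does (P? x)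
... | true  = trans (fromℕ-+ 1 (length (filter P? xs))) (cong (1ℚ +_) (length-filter≡Σl P? xs))
... | false = trans (length-filter≡Σl P? xs) (sym (ℚP.+-identityˡ _))

fromℕ-sumℕ : ∀ (xs : List X) g → fromℕ (sumℕ (map g xs)) ≡ Σl xs (fromℕ ∘ g)
fromℕ-sumℕ []       g = refl
fromℕ-sumℕ (x ∷ xs) g = trans (fromℕ-+ (g x) _) (cong (fromℕ (g x) +_) (fromℕ-sumℕ xs g))

σ : ℕ → (ℕ → ℚ) → ℚ
σ zero    f = 0ℚ
σ (suc n) f = f 0 + σ n (f ∘ suc)

Σl-applyUpTo : ∀ n (g : ℕ → X) (f : X → ℚ) → Σl (applyUpTo g n) f ≡ σ n (f ∘ g)
Σl-applyUpTo zero    g f = refl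
Σl-applyUpTo (suc n) g f = cong (f (g 0) +_) (Σl-applyUpTo n (g ∘ suc) f)

Σl-upTo : ∀ n f → Σl (upTo n) f ≡ σ n f
Σl-upTo n f = Σl-applyUpTo n (λ a → a) f

Σl-range : ∀ n f → Σl (range n) f ≡ σ n (f ∘ suc)
Σl-range n f = trans (Σl-map (upTo n) suc f) (Σl-upTo n (f ∘ suc))

σ-cong-< : ∀ n {f g} → (∀ a → a < n → f a ≡ g a) → σ n f ≡ σ n g
σ-cong-< zero    e = refl
σ-cong-< (suc n) e = cong₂ _+_ (e 0 (s≤s z≤n)) (σ-cong-< n (λ a a<n → e (suc a) (s≤s a<n)))

σ-cong : ∀ n {f g} → (∀ a → f a ≡ g a) → σ n f ≡ σ n g
σ-cong n e = σ-cong-< n (λ a _ → e a)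

σ-vanishing : ∀ n f → (∀ a → a < n → f a ≡ 0ℚ) → σ n f ≡ 0ℚ
σ-vanishing n f e = trans (σ-cong-< n e) (trans (sym (Σl-upTo n _)) (Σl-zero (upTo n)))

σ-tail : ∀ n f → f 0 ≡ 0ℚ → σ (suc n) f ≡ σ n (f ∘ suc)
σ-tail n f f₀ = trans (cong (_+ σ n (f ∘ suc)) f₀) (ℚP.+-identityˡ (σ n (f ∘ suc)))

σ-+ : ∀ n f g → σ n (λ a → f a + g a) ≡ σ n f + σ n g
σ-+ n f g = trans (sym (Σl-upTo n _)) (trans (Σl-+ (upTo n) f g) (cong₂ _+_ (Σl-upTo n f) (Σl-upTo n g)))

σ-*ˡ : ∀ n c f → σ n (λ a → c * f a) ≡ c * σ n f
σ-*ˡ n c f = trans (sym (Σl-upTo n _)) (trans (Σl-*ˡ (upTo n) c f) (cong (c *_) (Σl-upTo n f)))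

σ-*ʳ : ∀ n c f → σ n (λ a → f a * c) ≡ σ n f * c
σ-*ʳ n c f = trans (sym (Σl-upTo n _)) (trans (Σl-*ʳ (upTo n) c f) (cong (_* c) (Σl-upTo n f)))

σ-comm : ∀ m n (f : ℕ → ℕ → ℚ) → σ m (λ a → σ n (f a)) ≡ σ n (λ b → σ m (λ a → f a b))
σ-comm m n f = begin
  σ m (λ a → σ n (f a))                    ≡⟨ sym (Σl-upTo m _) ⟩
  Σl (upTo m) (λ a → σ n (f a))            ≡⟨ Σl-cong (upTo m) (λ a → sym (Σl-upTo n (f a))) ⟩
  Σl (upTo m) (λ a → Σl (upTo n) (f a))    ≡⟨ Σl-comm (upTo m) (upTo n) f ⟩
  Σl (upTo n) (λ b → Σl (upTo m) (λ a → f a b)) ≡⟨ Σl-cong (upTo n) (λ b → Σl-upTo m _) ⟩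
  Σl (upTo n) (λ b → σ m (λ a → f a b))    ≡⟨ Σl-upTo n _ ⟩
  σ n (λ b → σ m (λ a → f a b))            ∎
  where open ≡-Reasoning

σ-split : ∀ m n f → σ (m ℕ.+ n) f ≡ σ m f + σ n (λ a → f (m ℕ.+ a))
σ-split zero    n f = sym (ℚP.+-identityˡ (σ n f))
σ-split (suc m) n f =
  trans (cong (f 0 +_) (σ-split m n (f ∘ suc))) (sym (ℚP.+-assoc (f 0) _ _))

σ-truncate : ∀ p n f → p ≤ n → (∀ a → p ≤ a → f a ≡ 0ℚ) → σ n f ≡ σ p f
σ-truncate p n f p≤n f≡0 = begin
  σ n f                                  ≡⟨ cong (λ l → σ l f) (sym (ℕP.m+[n∸m]≡n p≤n)) ⟩
  σ (p ℕ.+ (n ∸ p)) f                    ≡⟨ σ-split p (n ∸ p) f ⟩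
  σ p f + σ (n ∸ p) (λ a → f (p ℕ.+ a))  ≡⟨ cong (σ p f +_) tail≡0 ⟩
  σ p f + 0ℚ                             ≡⟨ ℚP.+-identityʳ (σ p f) ⟩
  σ p f                                  ∎
  where
  open ≡-Reasoning
  tail≡0 : σ (n ∸ p) (λ a → f (p ℕ.+ a)) ≡ 0ℚ
  tail≡0 = σ-vanishing (n ∸ p) _ (λ a _ → f≡0 (p ℕ.+ a) (ℕP.m≤m+n p a))

σ-snoc : ∀ n f → σ (suc n) f ≡ σ n f + f n
σ-snoc n f = trans (cong (λ m → σ m f) (ℕP.+-comm 1 n))
  (trans (σ-split n 1 f) (cong (σ n f +_) (trans (ℚP.+-identityʳ _) (cong f (ℕP.+-identityʳ n)))))

σ-reverse : ∀ n f → σ n f ≡ σ n (λ a → f (n ∸ suc a))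
σ-reverse zero    f = refl
σ-reverse (suc n) f = begin
  σ (suc n) f                      ≡⟨ σ-snoc n f ⟩
  σ n f + f n                      ≡⟨ cong (_+ f n) (σ-reverse n f) ⟩
  σ n (λ a → f (n ∸ suc a)) + f n  ≡⟨ ℚP.+-comm _ (f n) ⟩
  f n + σ n (λ a → f (n ∸ suc a))  ∎
  where open ≡-Reasoning

σ-single : ∀ n k f → k < n → (∀ a → a < n → a ≢ k → f a ≡ 0ℚ) → σ n f ≡ f k
σ-single (suc n) zero f _ e =
  trans (cong (f 0 +_) (σ-vanishing n (f ∘ suc) (λ a a<n → e (suc a) (s≤s a<n) (λ ()))))
        (ℚP.+-identityʳ (f 0))
σ-single (suc n) (suc k) f (s≤s k<n) e =
  trans (cong₂ _+_ (e 0 (s≤s z≤n) (λ ()))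
                   (σ-single n k (f ∘ suc) k<n (λ a a<n a≢k → e (suc a) (s≤s a<n) (a≢k ∘ ℕP.suc-injective))))
        (ℚP.+-identityˡ (f (suc k)))

-- Convolution of power series

infixl 5 _⊕_
infixr 7 _·_

_⊕_ : PS → PS → PS
(f ⊕ g) a = f a + g a

_·_ : ℚ → PS → PS
(c · f) a = c * f a

shift : PS → PS
shift f = f ∘ suc

0S : PS
0S _ = 0ℚ

⊛-coeff : ∀ f g N → (f ⊛ g) N ≡ σ (suc N) (λ a → f a * g (N ∸ a))
⊛-coeff f g N = Σl-upTo (suc N) (λ a → f a * g (N ∸ a))

⊛-0 : ∀ f g → (f ⊛ g) 0 ≡ f 0 * g 0
⊛-0 f g = ℚP.+-identityʳ (f 0 * g 0)

⊛-suc : ∀ f g M → (f ⊛ g) (suc M) ≡ f 0 * g (suc M) + (shift f ⊛ g) M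
⊛-suc f g M = trans (⊛-coeff f g (suc M)) (cong (f 0 * g (suc M) +_) (sym (⊛-coeff (shift f) g M)))

⊛-cong-≤ : ∀ N {f f′ g g′} → (∀ a → a ≤ N → f a ≡ f′ a) → (∀ a → a ≤ N → g a ≡ g′ a) →
  (f ⊛ g) N ≡ (f′ ⊛ g′) N
⊛-cong-≤ N {f} {f′} {g} {g′} ef eg = begin
  (f ⊛ g) N                            ≡⟨ ⊛-coeff f g N ⟩
  σ (suc N) (λ a → f a * g (N ∸ a))    ≡⟨ σ-cong-< (suc N) (λ a a<sN →
                                            cong₂ _*_ (ef a (ℕP.≤-pred a<sN)) (eg (N ∸ a) (ℕP.m∸n≤m N a))) ⟩
  σ (suc N) (λ a → f′ a * g′ (N ∸ a))  ≡⟨ sym (⊛-coeff f′ g′ N) ⟩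
  (f′ ⊛ g′) N                          ∎
  where open ≡-Reasoning

⊛-cong : ∀ {f f′ g g′} → f ≗ f′ → g ≗ g′ → f ⊛ g ≗ f′ ⊛ g′
⊛-cong ef eg N = ⊛-cong-≤ N (λ a _ → ef a) (λ a _ → eg a)

⊛-congˡ : ∀ {f f′} g → f ≗ f′ → f ⊛ g ≗ f′ ⊛ g
⊛-congˡ {f} {f′} g e = ⊛-cong {f} {f′} {g} {g} e (λ _ → refl)

⊛-congʳ : ∀ f {g g′} → g ≗ g′ → f ⊛ g ≗ f ⊛ g′
⊛-congʳ f {g} {g′} e = ⊛-cong {f} {f} {g} {g′} (λ _ → refl) e

⊛-comm : ∀ f g → f ⊛ g ≗ g ⊛ f
⊛-comm f g N = begin
  (f ⊛ g) N                                            ≡⟨ ⊛-coeff f g N ⟩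
  σ (suc N) (λ a → f a * g (N ∸ a))                    ≡⟨ σ-reverse (suc N) (λ a → f a * g (N ∸ a)) ⟩
  σ (suc N) (λ a → f (N ∸ a) * g (N ∸ (N ∸ a)))        ≡⟨ σ-cong-< (suc N) (λ a a<sN →
       trans (ℚP.*-comm (f (N ∸ a)) (g (N ∸ (N ∸ a)))) (cong (λ b → g b * f (N ∸ a)) (ℕP.m∸[m∸n]≡n (ℕP.≤-pred a<sN)))) ⟩
  σ (suc N) (λ a → g a * f (N ∸ a))                    ≡⟨ sym (⊛-coeff g f N) ⟩
  (g ⊛ f) N                                            ∎
  where open ≡-Reasoning

⊛-distribʳ-⊕ : ∀ f g h → (f ⊕ g) ⊛ h ≗ f ⊛ h ⊕ g ⊛ h
⊛-distribʳ-⊕ f g h N = begin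
  ((f ⊕ g) ⊛ h) N                                              ≡⟨ ⊛-coeff (f ⊕ g) h N ⟩
  σ (suc N) (λ a → (f a + g a) * h (N ∸ a))                    ≡⟨ σ-cong (suc N) (λ a → ℚP.*-distribʳ-+ (h (N ∸ a)) (f a) (g a)) ⟩
  σ (suc N) (λ a → f a * h (N ∸ a) + g a * h (N ∸ a))          ≡⟨ σ-+ (suc N) (λ a → f a * h (N ∸ a)) (λ a → g a * h (N ∸ a)) ⟩
  σ (suc N) (λ a → f a * h (N ∸ a)) + σ (suc N) (λ a → g a * h (N ∸ a))
                                                               ≡⟨ sym (cong₂ _+_ (⊛-coeff f h N) (⊛-coeff g h N)) ⟩
  (f ⊛ h) N + (g ⊛ h) N                                        ∎
  where open ≡-Reasoning

⊛-·ˡ : ∀ c f h → (c · f) ⊛ h ≗ c · (f ⊛ h)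
⊛-·ˡ c f h N = begin
  ((c · f) ⊛ h) N                          ≡⟨ ⊛-coeff (c · f) h N ⟩
  σ (suc N) (λ a → c * f a * h (N ∸ a))    ≡⟨ σ-cong (suc N) (λ a → ℚP.*-assoc c (f a) (h (N ∸ a))) ⟩
  σ (suc N) (λ a → c * (f a * h (N ∸ a)))  ≡⟨ σ-*ˡ (suc N) c (λ a → f a * h (N ∸ a)) ⟩
  c * σ (suc N) (λ a → f a * h (N ∸ a))    ≡⟨ cong (c *_) (sym (⊛-coeff f h N)) ⟩
  c * (f ⊛ h) N                            ∎
  where open ≡-Reasoning

⊛-·ʳ : ∀ c f h → h ⊛ (c · f) ≗ c · (h ⊛ f)
⊛-·ʳ c f h N = trans (⊛-comm h (c · f) N) (trans (⊛-·ˡ c f h N) (cong (c *_) (⊛-comm f h N)))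

⊛-zeroˡ : ∀ h → 0S ⊛ h ≗ 0S
⊛-zeroˡ h N = trans (⊛-coeff 0S h N) (σ-vanishing (suc N) _ (λ a _ → ℚP.*-zeroˡ (h (N ∸ a))))

⊛-zeroʳ : ∀ h → h ⊛ 0S ≗ 0S
⊛-zeroʳ h N = trans (⊛-comm h 0S N) (⊛-zeroˡ h N)

⊛-assoc : ∀ f g h → (f ⊛ g) ⊛ h ≗ f ⊛ (g ⊛ h)
⊛-assoc f g h zero = begin
  ((f ⊛ g) ⊛ h) 0        ≡⟨ ⊛-0 (f ⊛ g) h ⟩
  (f ⊛ g) 0 * h 0        ≡⟨ cong (_* h 0) (⊛-0 f g) ⟩
  f 0 * g 0 * h 0        ≡⟨ ℚP.*-assoc (f 0) (g 0) (h 0) ⟩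
  f 0 * (g 0 * h 0)      ≡⟨ cong (f 0 *_) (sym (⊛-0 g h)) ⟩
  f 0 * (g ⊛ h) 0        ≡⟨ sym (⊛-0 f (g ⊛ h)) ⟩
  (f ⊛ (g ⊛ h)) 0        ∎
  where open ≡-Reasoning
⊛-assoc f g h (suc M) = begin
  ((f ⊛ g) ⊛ h) (suc M)
    ≡⟨ ⊛-suc (f ⊛ g) h M ⟩
  (f ⊛ g) 0 * h (suc M) + (shift (f ⊛ g) ⊛ h) M
    ≡⟨ cong₂ _+_ (cong (_* h (suc M)) (⊛-0 f g)) (⊛-congˡ h (⊛-suc f g) M) ⟩
  f 0 * g 0 * h (suc M) + ((f 0 · shift g ⊕ shift f ⊛ g) ⊛ h) M
    ≡⟨ cong (f 0 * g 0 * h (suc M) +_) (⊛-distribʳ-⊕ (f 0 · shift g) (shift f ⊛ g) h M) ⟩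
  f 0 * g 0 * h (suc M) + (((f 0 · shift g) ⊛ h) M + ((shift f ⊛ g) ⊛ h) M)
    ≡⟨ cong (f 0 * g 0 * h (suc M) +_) (cong₂ _+_ (⊛-·ˡ (f 0) (shift g) h M) (⊛-assoc (shift f) g h M)) ⟩
  f 0 * g 0 * h (suc M) + (f 0 * (shift g ⊛ h) M + (shift f ⊛ (g ⊛ h)) M)
    ≡⟨ regroup (f 0) (g 0) (h (suc M)) ((shift g ⊛ h) M) ((shift f ⊛ (g ⊛ h)) M) ⟩
  f 0 * (g 0 * h (suc M) + (shift g ⊛ h) M) + (shift f ⊛ (g ⊛ h)) M
    ≡⟨ cong (λ x → f 0 * x + (shift f ⊛ (g ⊛ h)) M) (sym (⊛-suc g h M)) ⟩
  f 0 * (g ⊛ h) (suc M) + (shift f ⊛ (g ⊛ h)) M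
    ≡⟨ sym (⊛-suc f (g ⊛ h) M) ⟩
  (f ⊛ (g ⊛ h)) (suc M) ∎
  where
  open ≡-Reasoning
  regroup : ∀ a b c d e → a * b * c + (a * d + e) ≡ a * (b * c + d) + e
  regroup = solve 5 (λ a b c d e → a :* b :* c :+ (a :* d :+ e) := a :* (b :* c :+ d) :+ e) refl


-- Logarithmic derivatives

D : PS → PS
D f a = fromℕ a * f a

D-0 : ∀ f → D f 0 ≡ 0ℚ
D-0 f = ℚP.*-zeroˡ (f 0)

D-⊛ : ∀ f g → D (f ⊛ g) ≗ D f ⊛ g ⊕ f ⊛ D g
D-⊛ f g N = begin
  fromℕ N * (f ⊛ g) N
    ≡⟨ cong (fromℕ N *_) (⊛-coeff f g N) ⟩
  fromℕ N * σ (suc N) (λ a → f a * g (N ∸ a))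
    ≡⟨ sym (σ-*ˡ (suc N) (fromℕ N) (λ a → f a * g (N ∸ a))) ⟩
  σ (suc N) (λ a → fromℕ N * (f a * g (N ∸ a)))
    ≡⟨ σ-cong-< (suc N) (λ a a<sN → split a (ℕP.≤-pred a<sN)) ⟩
  σ (suc N) (λ a → fromℕ a * f a * g (N ∸ a) + f a * (fromℕ (N ∸ a) * g (N ∸ a)))
    ≡⟨ σ-+ (suc N) (λ a → fromℕ a * f a * g (N ∸ a)) (λ a → f a * (fromℕ (N ∸ a) * g (N ∸ a))) ⟩
  σ (suc N) (λ a → fromℕ a * f a * g (N ∸ a)) + σ (suc N) (λ a → f a * (fromℕ (N ∸ a) * g (N ∸ a)))
    ≡⟨ sym (cong₂ _+_ (⊛-coeff (D f) g N) (⊛-coeff f (D g) N)) ⟩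
  (D f ⊛ g) N + (f ⊛ D g) N ∎
  where
  open ≡-Reasoning
  distrib : ∀ x y u v → (x + y) * (u * v) ≡ x * u * v + u * (y * v)
  distrib = solve 4 (λ x y u v → (x :+ y) :* (u :* v) := x :* u :* v :+ u :* (y :* v)) refl
  split : ∀ a → a ≤ N →
    fromℕ N * (f a * g (N ∸ a)) ≡ fromℕ a * f a * g (N ∸ a) + f a * (fromℕ (N ∸ a) * g (N ∸ a))
  split a a≤N = begin
    fromℕ N * (f a * g (N ∸ a))                  ≡⟨ cong (λ x → fromℕ x * (f a * g (N ∸ a))) (sym (ℕP.m+[n∸m]≡n a≤N)) ⟩
    fromℕ (a ℕ.+ (N ∸ a)) * (f a * g (N ∸ a))    ≡⟨ cong (_* (f a * g (N ∸ a))) (fromℕ-+ a (N ∸ a)) ⟩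
    (fromℕ a + fromℕ (N ∸ a)) * (f a * g (N ∸ a)) ≡⟨ distrib (fromℕ a) (fromℕ (N ∸ a)) (f a) (g (N ∸ a)) ⟩
    fromℕ a * f a * g (N ∸ a) + f a * (fromℕ (N ∸ a) * g (N ∸ a)) ∎

D-oneS : D oneS ≗ 0S
D-oneS zero    = refl
D-oneS (suc N) = ℚP.*-zeroʳ (fromℕ (suc N))

-- z F′ = A F, i.e. A = z F′ / F.
LogDeriv : PS → PS → Set
LogDeriv A F = D F ≗ A ⊛ F

LogDeriv-cong : ∀ {A A′ F} → A ≗ A′ → LogDeriv A F → LogDeriv A′ F
LogDeriv-cong {F = F} A≗A′ ld N = trans (ld N) (⊛-congˡ F A≗A′ N)

LogDeriv-oneS : LogDeriv 0S oneS
LogDeriv-oneS N = trans (D-oneS N) (sym (⊛-zeroˡ oneS N))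

LogDeriv-⊛ : ∀ {A B F G} → LogDeriv A F → LogDeriv B G → LogDeriv (A ⊕ B) (F ⊛ G)
LogDeriv-⊛ {A} {B} {F} {G} ldF ldG N = begin
  D (F ⊛ G) N                           ≡⟨ D-⊛ F G N ⟩
  (D F ⊛ G) N + (F ⊛ D G) N             ≡⟨ cong₂ _+_ (⊛-congˡ G ldF N) (⊛-congʳ F ldG N) ⟩
  ((A ⊛ F) ⊛ G) N + (F ⊛ (B ⊛ G)) N     ≡⟨ cong₂ _+_ (⊛-assoc A F G N) (sym (⊛-assoc F B G N)) ⟩
  (A ⊛ (F ⊛ G)) N + ((F ⊛ B) ⊛ G) N     ≡⟨ cong ((A ⊛ (F ⊛ G)) N +_) (⊛-congˡ G (⊛-comm F B) N) ⟩
  (A ⊛ (F ⊛ G)) N + ((B ⊛ F) ⊛ G) N     ≡⟨ cong ((A ⊛ (F ⊛ G)) N +_) (⊛-assoc B F G N) ⟩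
  (A ⊛ (F ⊛ G)) N + (B ⊛ (F ⊛ G)) N     ≡⟨ sym (⊛-distribʳ-⊕ A B (F ⊛ G) N) ⟩
  ((A ⊕ B) ⊛ (F ⊛ G)) N                 ∎
  where open ≡-Reasoning

ΣS : List X → (X → PS) → PS
ΣS xs A a = Σl xs (λ x → A x a)

LogDeriv-prodS : ∀ {Q : X → Set} xs (F G : X → PS) → All Q xs → (∀ x → Q x → LogDeriv (G x) (F x)) →
  LogDeriv (ΣS xs G) (prodS (map F xs))
LogDeriv-prodS []       F G []         ld = LogDeriv-oneS
LogDeriv-prodS (x ∷ xs) F G (qx ∷ qxs) ld =
  LogDeriv-⊛ {G x} {ΣS xs G} {F x} {prodS (map F xs)} (ld x qx) (LogDeriv-prodS xs F G qxs ld)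

LogDeriv-powS : ∀ {A F} k → LogDeriv A F → LogDeriv (fromℕ k · A) (powS F k)
LogDeriv-powS {A} zero    ld = LogDeriv-cong (λ a → sym (ℚP.*-zeroˡ (A a))) LogDeriv-oneS
LogDeriv-powS {A} {F} (suc k) ld =
  LogDeriv-cong 1+k (LogDeriv-⊛ {A} {fromℕ k · A} {F} {powS F k} ld (LogDeriv-powS k ld))
  where
  1+k : A ⊕ fromℕ k · A ≗ fromℕ (suc k) · A
  1+k a = trans (cong (_+ fromℕ k * A a) (sym (ℚP.*-identityˡ (A a))))
                (trans (sym (ℚP.*-distribʳ-+ (A a) 1ℚ (fromℕ k))) (cong (_* A a) (sym (fromℕ-+ 1 k))))

prodS-0 : ∀ {Q : X → Set} xs (F : X → PS) → All Q xs → (∀ x → Q x → F x 0 ≡ 1ℚ) → prodS (map F xs) 0 ≡ 1ℚ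
prodS-0 []       F []         h = refl
prodS-0 (x ∷ xs) F (qx ∷ qxs) h = trans (⊛-0 (F x) (prodS (map F xs))) (cong₂ _*_ (h x qx) (prodS-0 xs F qxs h))

powS-0 : ∀ F k → F 0 ≡ 1ℚ → powS F k 0 ≡ 1ℚ
powS-0 F zero    _  = refl
powS-0 F (suc k) F₀ = trans (⊛-0 F (powS F k)) (cong₂ _*_ F₀ (powS-0 F k F₀))

-- Coefficient n+1 of F is forced by (n+1) F (n+1) = Σ_{a ≤ n} A (a+1) F (n-a), as A 0 = 0.
LogDeriv-unique-≤ : ∀ N {A B F G} → F 0 ≡ G 0 → A 0 ≡ 0ℚ → (∀ a → a ≤ N → A a ≡ B a) →
  LogDeriv A F → LogDeriv B G → F N ≡ G N
LogDeriv-unique-≤ N {A} {B} {F} {G} F₀≡G₀ A₀≡0 A≡B ldF ldG = agree N ℕP.≤-refl N ℕP.≤-refl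
  where
  open ≡-Reasoning
  agree : ∀ M → M ≤ N → ∀ b → b ≤ M → F b ≡ G b
  agree zero    _    .zero z≤n = F₀≡G₀
  agree (suc M) sM≤N b b≤sM with ℕP.m≤n⇒m<n∨m≡n b≤sM
  ... | inj₁ (s≤s b≤M) = agree M (ℕP.<⇒≤ sM≤N) b b≤M
  ... | inj₂ refl = fromℕ-*-cancelˡ M (begin
    fromℕ (suc M) * F (suc M)          ≡⟨ ldF (suc M) ⟩
    (A ⊛ F) (suc M)                    ≡⟨ ⊛-suc A F M ⟩
    A 0 * F (suc M) + (shift A ⊛ F) M  ≡⟨ cong₂ _+_ lead rest ⟩
    B 0 * G (suc M) + (shift B ⊛ G) M  ≡⟨ sym (⊛-suc B G M) ⟩
    (B ⊛ G) (suc M)                    ≡⟨ sym (ldG (suc M)) ⟩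
    fromℕ (suc M) * G (suc M)          ∎)
    where
    B₀≡0 : B 0 ≡ 0ℚ
    B₀≡0 = trans (sym (A≡B 0 z≤n)) A₀≡0
    lead : A 0 * F (suc M) ≡ B 0 * G (suc M)
    lead = trans (cong (_* F (suc M)) A₀≡0)
                 (trans (ℚP.*-zeroˡ (F (suc M))) (sym (trans (cong (_* G (suc M)) B₀≡0) (ℚP.*-zeroˡ (G (suc M))))))
    rest : (shift A ⊛ F) M ≡ (shift B ⊛ G) M
    rest = ⊛-cong-≤ M (λ a a≤M → A≡B (suc a) (ℕP.≤-trans (s≤s a≤M) sM≤N))
                      (λ a a≤M → agree M (ℕP.<⇒≤ sM≤N) a a≤M)


-- The binomial series (1 - z^m)^s

prodℚ-applyUpTo-suc : ∀ (g : ℕ → ℚ) k → prodℚ (applyUpTo g (suc k)) ≡ prodℚ (applyUpTo g k) * g k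
prodℚ-applyUpTo-suc g zero    = trans (ℚP.*-identityʳ (g 0)) (sym (ℚP.*-identityˡ (g 0)))
prodℚ-applyUpTo-suc g (suc k) =
  trans (cong (g 0 *_) (prodℚ-applyUpTo-suc (g ∘ suc) k)) (sym (ℚP.*-assoc (g 0) _ (g (suc k))))

negBinom-suc : ∀ s k → negBinom s (suc k) ≡ negBinom s k * ((fromℕ k - s) * inv (suc k))
negBinom-suc s k = begin
  prodℚ (map g (upTo (suc k)))         ≡⟨ cong prodℚ (ListP.map-upTo g (suc k)) ⟩
  prodℚ (applyUpTo g (suc k))          ≡⟨ prodℚ-applyUpTo-suc g k ⟩
  prodℚ (applyUpTo g k) * g k          ≡⟨ cong (λ xs → prodℚ xs * g k) (sym (ListP.map-upTo g k)) ⟩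
  prodℚ (map g (upTo k)) * g k         ∎
  where
  open ≡-Reasoning
  g = λ t → (fromℕ t - s) * inv (suc t)

-- The coefficients c q of (1 - z)^s satisfy q c q = - s Σ_{l<q} c l, i.e. (1 - z) z F′ = - s z F.
negBinom-recurrence : ∀ s q → fromℕ q * negBinom s q ≡ (- s) * σ q (negBinom s)
negBinom-recurrence s zero    = trans (ℚP.*-zeroˡ 1ℚ) (sym (ℚP.*-zeroʳ (- s)))
negBinom-recurrence s (suc q) = begin
  fromℕ (suc q) * negBinom s (suc q)                       ≡⟨ cong (fromℕ (suc q) *_) (negBinom-suc s q) ⟩
  fromℕ (suc q) * (c * ((fromℕ q - s) * inv (suc q)))      ≡⟨ regroup (fromℕ (suc q)) c (fromℕ q - s) (inv (suc q)) ⟩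
  c * (fromℕ q - s) * (fromℕ (suc q) * inv (suc q))        ≡⟨ cong (c * (fromℕ q - s) *_) (fromℕ*inv≡1 q) ⟩
  c * (fromℕ q - s) * 1ℚ                                   ≡⟨ expand c (fromℕ q) s ⟩
  fromℕ q * c + (- s) * c                                  ≡⟨ cong (_+ (- s) * c) (negBinom-recurrence s q) ⟩
  (- s) * σ q (negBinom s) + (- s) * c                     ≡⟨ sym (ℚP.*-distribˡ-+ (- s) _ c) ⟩
  (- s) * (σ q (negBinom s) + c)                           ≡⟨ cong ((- s) *_) (sym (σ-snoc q (negBinom s))) ⟩
  (- s) * σ (suc q) (negBinom s)                           ∎
  where
  open ≡-Reasoning
  c = negBinom s q
  regroup : ∀ F c x I → F * (c * (x * I)) ≡ c * x * (F * I)
  regroup = solve 4 (λ F c x I → F :* (c :* (x :* I)) := c :* x :* (F :* I)) refl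
  expand : ∀ c f s → c * (f - s) * 1ℚ ≡ f * c + (- s) * c
  expand = solve 3 (λ c f s → c :* (f :- s) :* con 1ℚ := f :* c :+ (:- s) :* c) refl

binomTerm : ℕ → ℚ → ℕ → ℕ → ℚ
binomTerm m s N k = when (does (m ℕ.* k ≟ N)) (negBinom s k)

binomS-coeff : ∀ m s N → binomS m s N ≡ σ (suc N) (binomTerm m s N)
binomS-coeff m s N = Σl-upTo (suc N) (binomTerm m s N)

binomS-0 : ∀ m s → binomS m s 0 ≡ 1ℚ
binomS-0 m s = trans (binomS-coeff m s 0)
  (trans (ℚP.+-identityʳ (binomTerm m s 0 0)) (when-yes (m ℕ.* 0 ≟ 0) (negBinom s 0) (ℕP.*-zeroʳ m)))

binomS-nonmultiple : ∀ m s N → ¬ (m ∣ N) → binomS m s N ≡ 0ℚ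
binomS-nonmultiple m s N m∤N = trans (binomS-coeff m s N) (σ-vanishing (suc N) (binomTerm m s N) (λ k _ →
  when-no (m ℕ.* k ≟ N) (negBinom s k) (λ mk≡N → m∤N (divides k (trans (sym mk≡N) (ℕP.*-comm m k))))))

binomS-multiple : ∀ m s q → .{{_ : ℕ.NonZero m}} → binomS m s (q ℕ.* m) ≡ negBinom s q
binomS-multiple m s q = trans (binomS-coeff m s (q ℕ.* m))
  (trans (σ-single (suc (q ℕ.* m)) q (binomTerm m s (q ℕ.* m)) (s≤s (ℕP.m≤m*n q m)) (λ k _ k≢q →
            when-no (m ℕ.* k ≟ q ℕ.* m) (negBinom s k)
                    (λ mk≡qm → k≢q (ℕP.*-cancelʳ-≡ k q m (trans (ℕP.*-comm k m) mk≡qm)))))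
         (when-yes (m ℕ.* q ≟ q ℕ.* m) (negBinom s q) (ℕP.*-comm m q)))

multiplesS : ℕ → ℚ → PS
multiplesS m κ zero    = 0ℚ
multiplesS m κ (suc a) = when (does (m ∣? suc a)) κ

multiplesS-nonmultiple : ∀ m κ a → ¬ (m ∣ a) → multiplesS m κ a ≡ 0ℚ
multiplesS-nonmultiple m κ zero    _   = refl
multiplesS-nonmultiple m κ (suc a) m∤a = when-no (m ∣? suc a) κ m∤a

multiplesS-multiple : ∀ m κ l → multiplesS (suc m) κ (suc l ℕ.* suc m) ≡ κ
multiplesS-multiple m κ l = when-yes (suc m ∣? suc l ℕ.* suc m) κ (∣.n∣m*n (suc l))

σ-multiples : ∀ m q h → (∀ a → ¬ (suc m ∣ a) → h a ≡ 0ℚ) →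
  σ (suc (q ℕ.* suc m)) h ≡ σ (suc q) (λ l → h (l ℕ.* suc m))
σ-multiples m zero    h h-supp = refl
σ-multiples m (suc q) h h-supp = begin
  σ (suc (suc q ℕ.* m′)) h
    ≡⟨ cong (λ l → σ l h) (cong suc (ℕP.+-comm m′ (q ℕ.* m′))) ⟩
  σ (suc (q ℕ.* m′) ℕ.+ m′) h
    ≡⟨ σ-split (suc (q ℕ.* m′)) m′ h ⟩
  σ (suc (q ℕ.* m′)) h + σ m′ (λ r → h (suc (q ℕ.* m′) ℕ.+ r))
    ≡⟨ cong₂ _+_ (σ-multiples m q h h-supp) (σ-single m′ m _ ℕP.≤-refl gap) ⟩
  σ (suc q) (λ l → h (l ℕ.* m′)) + h (suc (q ℕ.* m′) ℕ.+ m)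
    ≡⟨ cong (λ x → σ (suc q) (λ l → h (l ℕ.* m′)) + h (suc x)) (ℕP.+-comm (q ℕ.* m′) m) ⟩
  σ (suc q) (λ l → h (l ℕ.* m′)) + h (suc q ℕ.* m′)
    ≡⟨ sym (σ-snoc (suc q) (λ l → h (l ℕ.* m′))) ⟩
  σ (suc (suc q)) (λ l → h (l ℕ.* m′)) ∎
  where
  open ≡-Reasoning
  m′ = suc m
  gap : ∀ r → r < m′ → r ≢ m → h (suc (q ℕ.* m′) ℕ.+ r) ≡ 0ℚ
  gap r r<m′ r≢m = h-supp _ (λ m′∣ → r≢m (ℕP.≤-antisym (ℕP.≤-pred r<m′) (ℕP.≤-pred (∣.∣⇒≤ (m′∣1+r m′∣)))))
    where
    m′∣1+r : m′ ∣ suc (q ℕ.* m′) ℕ.+ r → m′ ∣ suc r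
    m′∣1+r d = ∣.∣m+n∣m⇒∣n (subst (m′ ∣_) (sym (ℕP.+-suc (q ℕ.* m′) r)) d) (∣.n∣m*n q)

LogDeriv-binomS-nonmultiple : ∀ m s N → ¬ (suc m ∣ N) →
  D (binomS (suc m) s) N ≡ (multiplesS (suc m) (fromℕ (suc m) * (- s)) ⊛ binomS (suc m) s) N
LogDeriv-binomS-nonmultiple m s N m∤N = begin
  fromℕ N * B N                        ≡⟨ cong (fromℕ N *_) (binomS-nonmultiple (suc m) s N m∤N) ⟩
  fromℕ N * 0ℚ                         ≡⟨ ℚP.*-zeroʳ (fromℕ N) ⟩
  0ℚ                                   ≡⟨ sym (σ-vanishing (suc N) _ term≡0) ⟩
  σ (suc N) (λ a → A a * B (N ∸ a))    ≡⟨ sym (⊛-coeff A B N) ⟩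
  (A ⊛ B) N                            ∎
  where
  open ≡-Reasoning
  A = multiplesS (suc m) (fromℕ (suc m) * (- s))
  B = binomS (suc m) s
  term≡0 : ∀ a → a < suc N → A a * B (N ∸ a) ≡ 0ℚ
  term≡0 a a<sN with suc m ∣? a
  ... | no  m∤a = trans (cong (_* B (N ∸ a)) (multiplesS-nonmultiple (suc m) _ a m∤a)) (ℚP.*-zeroˡ (B (N ∸ a)))
  ... | yes m∣a = trans (cong (A a *_) (binomS-nonmultiple (suc m) s (N ∸ a) m∤N-a)) (ℚP.*-zeroʳ (A a))
    where
    m∤N-a : ¬ (suc m ∣ N ∸ a)
    m∤N-a m∣N-a = m∤N (∣.∣m∸n∣n⇒∣m (suc m) (ℕP.≤-pred a<sN) m∣N-a m∣a)

LogDeriv-binomS-multiple : ∀ m s q →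
  D (binomS (suc m) s) (q ℕ.* suc m) ≡ (multiplesS (suc m) (fromℕ (suc m) * (- s)) ⊛ binomS (suc m) s) (q ℕ.* suc m)
LogDeriv-binomS-multiple m s q = begin
  fromℕ (q ℕ.* m′) * B (q ℕ.* m′)
    ≡⟨ cong₂ _*_ (fromℕ-* q m′) (binomS-multiple m′ s q) ⟩
  fromℕ q * fromℕ m′ * negBinom s q
    ≡⟨ regroup (fromℕ q) (fromℕ m′) (negBinom s q) ⟩
  fromℕ m′ * (fromℕ q * negBinom s q)
    ≡⟨ cong (fromℕ m′ *_) (negBinom-recurrence s q) ⟩
  fromℕ m′ * ((- s) * σ q (negBinom s))
    ≡⟨ sym (ℚP.*-assoc (fromℕ m′) (- s) _) ⟩
  κ * σ q (negBinom s)
    ≡⟨ cong (κ *_) (σ-reverse q (negBinom s)) ⟩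
  κ * σ q (λ l → negBinom s (q ∸ suc l))
    ≡⟨ sym (σ-*ˡ q κ _) ⟩
  σ q (λ l → κ * negBinom s (q ∸ suc l))
    ≡⟨ σ-cong q (λ l → sym (cong₂ _*_ (multiplesS-multiple m κ l)
                    (trans (cong B (sym (ℕP.*-distribʳ-∸ m′ q (suc l)))) (binomS-multiple m′ s (q ∸ suc l))))) ⟩
  σ q (λ l → A (suc l ℕ.* m′) * B (q ℕ.* m′ ∸ suc l ℕ.* m′))
    ≡⟨ sym (σ-tail q (λ l → A (l ℕ.* m′) * B (q ℕ.* m′ ∸ l ℕ.* m′)) (ℚP.*-zeroˡ (B (q ℕ.* m′)))) ⟩
  σ (suc q) (λ l → A (l ℕ.* m′) * B (q ℕ.* m′ ∸ l ℕ.* m′))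
    ≡⟨ sym (σ-multiples m q (λ a → A a * B (q ℕ.* m′ ∸ a)) (λ a m∤a →
          trans (cong (_* B (q ℕ.* m′ ∸ a)) (multiplesS-nonmultiple m′ κ a m∤a)) (ℚP.*-zeroˡ (B (q ℕ.* m′ ∸ a))))) ⟩
  σ (suc (q ℕ.* m′)) (λ a → A a * B (q ℕ.* m′ ∸ a))
    ≡⟨ sym (⊛-coeff A B (q ℕ.* m′)) ⟩
  (A ⊛ B) (q ℕ.* m′) ∎
  where
  open ≡-Reasoning
  m′ = suc m
  κ = fromℕ m′ * (- s)
  A = multiplesS m′ κ
  B = binomS m′ s
  regroup : ∀ a b c → a * b * c ≡ b * (a * c)
  regroup = solve 3 (λ a b c → a :* b :* c := b :* (a :* c)) refl

LogDeriv-binomS : ∀ m s → 1 ≤ m → LogDeriv (multiplesS m (fromℕ m * (- s))) (binomS m s)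
LogDeriv-binomS (suc m) s _ N with suc m ∣? N
... | no  m∤N              = LogDeriv-binomS-nonmultiple m s N m∤N
... | yes (divides q refl) = LogDeriv-binomS-multiple m s q


-- The exponential series

powS-low : ∀ f → f 0 ≡ 0ℚ → ∀ k N → N < k → powS f k N ≡ 0ℚ
powS-low f f₀ (suc k) zero    _          =
  trans (⊛-0 f (powS f k)) (trans (cong (_* powS f k 0) f₀) (ℚP.*-zeroˡ (powS f k 0)))
powS-low f f₀ (suc k) (suc M) (s≤s M<k) = begin
  (f ⊛ powS f k) (suc M)                            ≡⟨ ⊛-suc f (powS f k) M ⟩
  f 0 * powS f k (suc M) + (shift f ⊛ powS f k) M   ≡⟨ cong₂ _+_ lead rest ⟩
  0ℚ + 0ℚ                                           ≡⟨ ℚP.+-identityˡ 0ℚ ⟩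
  0ℚ                                                ∎
  where
  open ≡-Reasoning
  lead : f 0 * powS f k (suc M) ≡ 0ℚ
  lead = trans (cong (_* powS f k (suc M)) f₀) (ℚP.*-zeroˡ (powS f k (suc M)))
  rest : (shift f ⊛ powS f k) M ≡ 0ℚ
  rest = trans (⊛-coeff (shift f) (powS f k) M) (σ-vanishing (suc M) _ (λ a _ →
    trans (cong (shift f a *_) (powS-low f f₀ k (M ∸ a) (ℕP.≤-<-trans (ℕP.m∸n≤m M a) M<k))) (ℚP.*-zeroʳ (shift f a))))

D-powS : ∀ f k → D (powS f (suc k)) ≗ fromℕ (suc k) · (D f ⊛ powS f k)
D-powS f zero N = begin
  D (f ⊛ oneS) N                       ≡⟨ D-⊛ f oneS N ⟩
  (D f ⊛ oneS) N + (f ⊛ D oneS) N      ≡⟨ cong ((D f ⊛ oneS) N +_) (trans (⊛-congʳ f D-oneS N) (⊛-zeroʳ f N)) ⟩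
  (D f ⊛ oneS) N + 0ℚ                  ≡⟨ ℚP.+-identityʳ _ ⟩
  (D f ⊛ oneS) N                       ≡⟨ sym (ℚP.*-identityˡ _) ⟩
  1ℚ * (D f ⊛ oneS) N                  ∎
  where open ≡-Reasoning
D-powS f (suc k) N = begin
  D (f ⊛ fᵏ⁺¹) N                                   ≡⟨ D-⊛ f fᵏ⁺¹ N ⟩
  (D f ⊛ fᵏ⁺¹) N + (f ⊛ D fᵏ⁺¹) N                  ≡⟨ cong ((D f ⊛ fᵏ⁺¹) N +_) (⊛-congʳ f (D-powS f k) N) ⟩
  (D f ⊛ fᵏ⁺¹) N + (f ⊛ (1+k · (D f ⊛ fᵏ))) N       ≡⟨ cong ((D f ⊛ fᵏ⁺¹) N +_) (⊛-·ʳ 1+k (D f ⊛ fᵏ) f N) ⟩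
  (D f ⊛ fᵏ⁺¹) N + 1+k * (f ⊛ (D f ⊛ fᵏ)) N         ≡⟨ cong (λ x → (D f ⊛ fᵏ⁺¹) N + 1+k * x) reorder ⟩
  (D f ⊛ fᵏ⁺¹) N + 1+k * (D f ⊛ fᵏ⁺¹) N             ≡⟨ collect ((D f ⊛ fᵏ⁺¹) N) 1+k ⟩
  (1ℚ + 1+k) * (D f ⊛ fᵏ⁺¹) N                       ≡⟨ cong (_* (D f ⊛ fᵏ⁺¹) N) (sym (fromℕ-+ 1 (suc k))) ⟩
  fromℕ (suc (suc k)) * (D f ⊛ fᵏ⁺¹) N              ∎
  where
  open ≡-Reasoning
  fᵏ = powS f k
  fᵏ⁺¹ = powS f (suc k)
  1+k = fromℕ (suc k)
  collect : ∀ x c → x + c * x ≡ (1ℚ + c) * x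
  collect = solve 2 (λ x c → x :+ c :* x := (con 1ℚ :+ c) :* x) refl
  reorder : (f ⊛ (D f ⊛ fᵏ)) N ≡ (D f ⊛ fᵏ⁺¹) N
  reorder = trans (sym (⊛-assoc f (D f) fᵏ N))
           (trans (⊛-congˡ fᵏ (⊛-comm f (D f)) N) (⊛-assoc (D f) f fᵏ N))

module _ (f : PS) (f₀ : f 0 ≡ 0ℚ) where

  expTerm : ℕ → ℕ → ℚ
  expTerm r j = powS f j r * inv (j !)

  -- Since f^j has no terms below z^j, any range of length beyond r gives the coefficient of z^r.
  expS-coeff : ∀ r n → r < n → expS f r ≡ σ n (expTerm r)
  expS-coeff r n r<n = trans (Σl-upTo (suc r) (expTerm r)) (sym (σ-truncate (suc r) n (expTerm r) r<n (λ j r<j →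
    trans (cong (_* inv (j !)) (powS-low f f₀ j r r<j)) (ℚP.*-zeroˡ (inv (j !))))))

  D-expS : ∀ N → D (expS f) N ≡ σ N (λ j → (D f ⊛ powS f j) N * inv (j !))
  D-expS N = begin
    fromℕ N * expS f N                                    ≡⟨ cong (fromℕ N *_) (expS-coeff N (suc N) ℕP.≤-refl) ⟩
    fromℕ N * σ (suc N) (expTerm N)                       ≡⟨ sym (σ-*ˡ (suc N) (fromℕ N) (expTerm N)) ⟩
    σ (suc N) (λ k → fromℕ N * (powS f k N * inv (k !)))
      ≡⟨ σ-cong (suc N) (λ k → sym (ℚP.*-assoc (fromℕ N) (powS f k N) (inv (k !)))) ⟩
    σ (suc N) (λ k → D (powS f k) N * inv (k !))
      ≡⟨ σ-tail N (λ k → D (powS f k) N * inv (k !)) (trans (cong (_* 1ℚ) (D-oneS N)) (ℚP.*-zeroˡ 1ℚ)) ⟩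
    σ N (λ j → D (powS f (suc j)) N * inv (suc j !))      ≡⟨ σ-cong N step ⟩
    σ N (λ j → (D f ⊛ powS f j) N * inv (j !))            ∎
    where
    open ≡-Reasoning
    swap : ∀ c x i → c * x * i ≡ x * (c * i)
    swap = solve 3 (λ c x i → c :* x :* i := x :* (c :* i)) refl
    step : ∀ j → D (powS f (suc j)) N * inv (suc j !) ≡ (D f ⊛ powS f j) N * inv (j !)
    step j = trans (cong (_* inv (suc j !)) (D-powS f j N))
      (trans (swap (fromℕ (suc j)) ((D f ⊛ powS f j) N) (inv (suc j !))) (cong ((D f ⊛ powS f j) N *_) (fromℕ*inv-! j)))

  LogDeriv-expS : LogDeriv (D f) (expS f)
  LogDeriv-expS N = begin
    D (expS f) N                                               ≡⟨ D-expS N ⟩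
    σ N (λ j → (D f ⊛ powS f j) N * inv (j !))                 ≡⟨ σ-cong N expand ⟩
    σ N (λ j → σ (suc N) (λ a → D f a * expTerm (N ∸ a) j))    ≡⟨ σ-comm N (suc N) (λ j a → D f a * expTerm (N ∸ a) j) ⟩
    σ (suc N) (λ a → σ N (λ j → D f a * expTerm (N ∸ a) j))    ≡⟨ σ-cong-< (suc N) (λ a a<sN →
                                                                    trans (σ-*ˡ N (D f a) (expTerm (N ∸ a))) (truncate a (ℕP.≤-pred a<sN))) ⟩
    σ (suc N) (λ a → D f a * expS f (N ∸ a))                   ≡⟨ sym (⊛-coeff (D f) (expS f) N) ⟩
    (D f ⊛ expS f) N                                           ∎
    where
    open ≡-Reasoning
    expand : ∀ j → (D f ⊛ powS f j) N * inv (j !) ≡ σ (suc N) (λ a → D f a * expTerm (N ∸ a) j)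
    expand j = trans (cong (_* inv (j !)) (⊛-coeff (D f) (powS f j) N))
      (trans (sym (σ-*ʳ (suc N) (inv (j !)) (λ a → D f a * powS f j (N ∸ a))))
             (σ-cong (suc N) (λ a → ℚP.*-assoc (D f a) (powS f j (N ∸ a)) (inv (j !)))))
    -- D f 0 = 0 kills the one term whose exponential coefficient would need the full range [0, N].
    truncate : ∀ a → a ≤ N → D f a * σ N (expTerm (N ∸ a)) ≡ D f a * expS f (N ∸ a)
    truncate zero    _    = trans (cong (_* σ N (expTerm N)) (D-0 f))
      (trans (ℚP.*-zeroˡ (σ N (expTerm N))) (sym (trans (cong (_* expS f N) (D-0 f)) (ℚP.*-zeroˡ (expS f N)))))
    truncate (suc b) sb≤N = cong (D f (suc b) *_) (sym (expS-coeff (N ∸ suc b) N (ℕP.∸-monoʳ-< (s≤s z≤n) sb≤N)))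


-- Sums over tuples

range-bounds : ∀ n → All (λ p → 1 ≤ p × p ≤ n) (range n)
range-bounds n = AllP.map⁺ (AllP.applyUpTo⁺₁ (λ a → a) n (λ a<n → s≤s z≤n , a<n))

IsTuple : ℕ → List ℕ → Set
IsTuple a u = length u ≡ a × 1 ≤ prodℕ u

tuples-IsTuple : ∀ a N → All (IsTuple a) (tuples a N)
tuples-IsTuple zero    N = (refl , s≤s z≤n) ∷ []
tuples-IsTuple (suc a) N = AllP.concat⁺ (AllP.map⁺ (All.map extend (range-bounds N)))
  where
  extend : ∀ {x} → 1 ≤ x × x ≤ N → All (IsTuple (suc a)) (map (x ∷_) (tuples a N))
  extend {x} (1≤x , _) = AllP.map⁺ (All.map (λ { (len , 1≤u) → cong suc len , ℕP.*-mono-≤ 1≤x 1≤u })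
                                            (tuples-IsTuple a N))

prodℕ-++ : ∀ u v → prodℕ (u ++ v) ≡ prodℕ u ℕ.* prodℕ v
prodℕ-++ []      v = sym (ℕP.+-identityʳ (prodℕ v))
prodℕ-++ (x ∷ u) v = trans (cong (x ℕ.*_) (prodℕ-++ u v)) (sym (ℕP.*-assoc x (prodℕ u) (prodℕ v)))

take-length-++ : ∀ (u v : List X) → take (length u) (u ++ v) ≡ u
take-length-++ []      v = refl
take-length-++ (x ∷ u) v = cong (x ∷_) (take-length-++ u v)

drop-length-++ : ∀ (u v : List X) → drop (length u) (u ++ v) ≡ v
drop-length-++ []      v = refl
drop-length-++ (x ∷ u) v = drop-length-++ u v

Σl-range-≤ : ∀ p N → p ≤ N → (F : ℕ → ℚ) → (∀ x → p < x → F x ≡ 0ℚ) → Σl (range N) F ≡ Σl (range p) F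
Σl-range-≤ p N p≤N F F-vanishes = trans (Σl-range N F)
  (trans (σ-truncate p N (F ∘ suc) p≤N (λ a p≤a → F-vanishes (suc a) (s≤s p≤a))) (sym (Σl-range p F)))

Σl-range-single : ∀ n k → 1 ≤ k → k ≤ n → (g : ℕ → ℚ) → (∀ p → p ≢ k → g p ≡ 0ℚ) → Σl (range n) g ≡ g k
Σl-range-single n (suc k) _ k<n g g-vanishes = trans (Σl-range n g)
  (σ-single n k (g ∘ suc) k<n (λ a _ a≢k → g-vanishes (suc a) (a≢k ∘ ℕP.suc-injective)))

Σl-tuples-+ : ∀ a b N (h : List ℕ → ℚ) →
  Σl (tuples (a ℕ.+ b) N) h ≡ Σl (tuples a N) (λ u → Σl (tuples b N) (λ v → h (u ++ v)))
Σl-tuples-+ zero    b N h = sym (ℚP.+-identityʳ (Σl (tuples b N) h))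
Σl-tuples-+ (suc a) b N h = begin
  Σl (concatMap (λ x → map (x ∷_) (tuples (a ℕ.+ b) N)) (range N)) h
    ≡⟨ Σl-concatMap (range N) _ h ⟩
  Σl (range N) (λ x → Σl (map (x ∷_) (tuples (a ℕ.+ b) N)) h)
    ≡⟨ Σl-cong (range N) (λ x → trans (Σl-map (tuples (a ℕ.+ b) N) (x ∷_) h) (Σl-tuples-+ a b N (h ∘ (x ∷_)))) ⟩
  Σl (range N) (λ x → Σl (tuples a N) (λ u → Σl (tuples b N) (λ v → h (x ∷ u ++ v))))
    ≡⟨ sym (Σl-cong (range N) (λ x → Σl-map (tuples a N) (x ∷_) H)) ⟩
  Σl (range N) (λ x → Σl (map (x ∷_) (tuples a N)) H)
    ≡⟨ sym (Σl-concatMap (range N) (λ x → map (x ∷_) (tuples a N)) H) ⟩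
  Σl (concatMap (λ x → map (x ∷_) (tuples a N)) (range N)) H ∎
  where
  open ≡-Reasoning
  H = λ u → Σl (tuples b N) (λ v → h (u ++ v))

-- Entries of a tuple are at most its product, so only [1 .. p] matters if products beyond p are ignored.
Σl-tuples-shrink : ∀ a N p → p ≤ N → (h : List ℕ → ℚ) → (∀ u → p < prodℕ u → h u ≡ 0ℚ) →
  Σl (tuples a N) h ≡ Σl (tuples a p) h
Σl-tuples-shrink a N p p≤N h h-vanishes = scaled a 1 (s≤s z≤n) h
  (λ u p<1*u → h-vanishes u (subst (p <_) (ℕP.*-identityˡ (prodℕ u)) p<1*u))
  where
  open ≡-Reasoning
  scaled : ∀ a c → 1 ≤ c → (h : List ℕ → ℚ) → (∀ u → p < c ℕ.* prodℕ u → h u ≡ 0ℚ) →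
    Σl (tuples a N) h ≡ Σl (tuples a p) h
  scaled zero    c _   h _         = refl
  scaled (suc a) c 1≤c h vanishes = begin
    Σl (concatMap (λ x → map (x ∷_) (tuples a N)) (range N)) h
      ≡⟨ Σl-concatMap (range N) _ h ⟩
    Σl (range N) (λ x → Σl (map (x ∷_) (tuples a N)) h)
      ≡⟨ Σl-cong-All (range N) (range-bounds N) (λ x (1≤x , _) → trans (Σl-map (tuples a N) (x ∷_) h)
           (scaled a (c ℕ.* x) (ℕP.*-mono-≤ 1≤c 1≤x) (h ∘ (x ∷_))
             (λ u lt → vanishes (x ∷ u) (subst (p <_) (ℕP.*-assoc c x (prodℕ u)) lt)))) ⟩
    Σl (range N) F
      ≡⟨ Σl-range-≤ p N p≤N F F-vanishes ⟩
    Σl (range p) F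
      ≡⟨ sym (Σl-cong (range p) (λ x → Σl-map (tuples a p) (x ∷_) h)) ⟩
    Σl (range p) (λ x → Σl (map (x ∷_) (tuples a p)) h)
      ≡⟨ sym (Σl-concatMap (range p) (λ x → map (x ∷_) (tuples a p)) h) ⟩
    Σl (concatMap (λ x → map (x ∷_) (tuples a p)) (range p)) h ∎
    where
    F : ℕ → ℚ
    F x = Σl (tuples a p) (h ∘ (x ∷_))
    F-vanishes : ∀ x → p < x → F x ≡ 0ℚ
    F-vanishes x p<x = trans (Σl-cong-All (tuples a p) (tuples-IsTuple a p) (λ u (_ , 1≤u) → vanishes (x ∷ u)
        (ℕP.<-≤-trans p<x (ℕP.≤-trans (ℕP.m≤m*n x (prodℕ u) ⦃ ℕ.>-nonZero 1≤u ⦄)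
                                      (ℕP.m≤n*m (x ℕ.* prodℕ u) c ⦃ ℕ.>-nonZero 1≤c ⦄)))))
      (Σl-zero (tuples a p))

Σl-tuples-count : ∀ a N p → p ≤ N → Σl (tuples a N) (λ u → when (does (prodℕ u ≟ p)) 1ℚ) ≡ fromℕ (τ a p)
Σl-tuples-count a N p p≤N = trans
  (Σl-tuples-shrink a N p p≤N _ (λ u p<u → when-no (prodℕ u ≟ p) 1ℚ (λ u≡p → ℕP.<-irrefl (sym u≡p) p<u)))
  (sym (length-filter≡Σl (λ t → prodℕ t ≟ p) (tuples a p)))

expand-range : ∀ n y → 1 ≤ y → (G : ℕ → ℚ) → (n < y → G y ≡ 0ℚ) → G y ≡ Σl (range n) (λ p → δ y p (G p))
expand-range n (suc y) _ G G-vanishes with suc y ℕ.≤? n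
... | yes y<n = sym (trans (Σl-range-single n (suc y) (s≤s z≤n) y<n _
                  (λ p p≢y → when-no (suc y ≟ p) (G p) (p≢y ∘ sym)))
                  (when-yes (suc y ≟ suc y) (G (suc y)) refl))
... | no  y≮n = trans (G-vanishes (ℕP.≰⇒> y≮n)) (sym (trans (Σl-range n _) (σ-vanishing n _
                  (λ a a<n → when-no (suc y ≟ suc a) (G (suc a)) (λ y≡a → y≮n (subst (_≤ n) (sym y≡a) a<n))))))

Σl-tuples-prodℕ : ∀ a N n → n ≤ N → (G : ℕ → ℚ) → (∀ y → 1 ≤ y → n < y → G y ≡ 0ℚ) →
  Σl (tuples a N) (G ∘ prodℕ) ≡ Σl (range n) (λ p → fromℕ (τ a p) * G p)
Σl-tuples-prodℕ a N n n≤N G G-vanishes = begin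
  Σl (tuples a N) (G ∘ prodℕ)
    ≡⟨ Σl-cong-All (tuples a N) (tuples-IsTuple a N) (λ u (_ , 1≤u) →
         expand-range n (prodℕ u) 1≤u G (G-vanishes (prodℕ u) 1≤u)) ⟩
  Σl (tuples a N) (λ u → Σl (range n) (λ p → δ (prodℕ u) p (G p)))
    ≡⟨ Σl-comm (tuples a N) (range n) _ ⟩
  Σl (range n) (λ p → Σl (tuples a N) (λ u → δ (prodℕ u) p (G p)))
    ≡⟨ Σl-cong-All (range n) (range-bounds n) (λ p (_ , p≤n) → count p (ℕP.≤-trans p≤n n≤N)) ⟩
  Σl (range n) (λ p → fromℕ (τ a p) * G p) ∎
  where
  open ≡-Reasoning
  count : ∀ p → p ≤ N → Σl (tuples a N) (λ u → δ (prodℕ u) p (G p)) ≡ fromℕ (τ a p) * G p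
  count p p≤N = begin
    Σl (tuples a N) (λ u → δ (prodℕ u) p (G p))                  ≡⟨ Σl-cong (tuples a N) (λ u → when≡*when1 _ (G p)) ⟩
    Σl (tuples a N) (λ u → G p * when (does (prodℕ u ≟ p)) 1ℚ)   ≡⟨ Σl-*ˡ (tuples a N) (G p) _ ⟩
    G p * Σl (tuples a N) (λ u → when (does (prodℕ u ≟ p)) 1ℚ)   ≡⟨ cong (G p *_) (Σl-tuples-count a N p p≤N) ⟩
    G p * fromℕ (τ a p)                                          ≡⟨ ℚP.*-comm (G p) _ ⟩
    fromℕ (τ a p) * G p                                          ∎


-- Weights of the factors of P

exponentP : ℕ → ℕ → List ℕ → ℚ
exponentP i j t = - frac (prodℕ (take i t)) (prodℕ (take j (drop i t)))

-- The κ of LogDeriv-binomS for the factor of t: m n₁⋯nᵢ/(d₁⋯dⱼ), with m the product of t.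
weight : ℕ → ℕ → List ℕ → ℚ
weight i j t = fromℕ (prodℕ t) * (- exponentP i j t)

fromℕ-*-frac : ∀ a b c → 1 ≤ b → fromℕ (a ℕ.* b ℕ.* c) * (- (- frac a b)) ≡ fromℕ (a ℕ.* a ℕ.* c)
fromℕ-*-frac a (suc b) c _ = begin
  fromℕ (a ℕ.* suc b ℕ.* c) * (- (- frac a (suc b)))
    ≡⟨ cong₂ _*_ (fromℕ-*³ a (suc b) c) (cong (λ x → - (- x)) (frac≡fromℕ*inv a b)) ⟩
  fromℕ a * fromℕ (suc b) * fromℕ c * (- (- (fromℕ a * inv (suc b))))
    ≡⟨ regroup (fromℕ a) (fromℕ (suc b)) (fromℕ c) (inv (suc b)) ⟩
  fromℕ a * fromℕ a * fromℕ c * (fromℕ (suc b) * inv (suc b))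
    ≡⟨ cong (fromℕ a * fromℕ a * fromℕ c *_) (fromℕ*inv≡1 b) ⟩
  fromℕ a * fromℕ a * fromℕ c * 1ℚ
    ≡⟨ ℚP.*-identityʳ _ ⟩
  fromℕ a * fromℕ a * fromℕ c
    ≡⟨ sym (fromℕ-*³ a a c) ⟩
  fromℕ (a ℕ.* a ℕ.* c) ∎
  where
  open ≡-Reasoning
  fromℕ-*³ : ∀ x y z → fromℕ (x ℕ.* y ℕ.* z) ≡ fromℕ x * fromℕ y * fromℕ z
  fromℕ-*³ x y z = trans (fromℕ-* (x ℕ.* y) z) (cong (_* fromℕ z) (fromℕ-* x y))
  regroup : ∀ a b c i → a * b * c * (- (- (a * i))) ≡ a * a * c * (b * i)
  regroup = solve 4 (λ a b c i → a :* b :* c :* (:- (:- (a :* i))) := a :* a :* c :* (b :* i)) refl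

weight-++ : ∀ i j (u v x : List ℕ) → length u ≡ i → length v ≡ j → 1 ≤ prodℕ v →
  weight i j ((u ++ v) ++ x) ≡ fromℕ (prodℕ u ℕ.* prodℕ u ℕ.* prodℕ x)
weight-++ .(length u) .(length v) u v x refl refl 1≤v = begin
  fromℕ (prodℕ t) * (- (- frac (prodℕ (take (length u) t)) (prodℕ (take (length v) (drop (length u) t)))))
    ≡⟨ cong₂ (λ a b → fromℕ (prodℕ t) * (- (- frac (prodℕ a) (prodℕ b)))) take-u take-v ⟩
  fromℕ (prodℕ t) * (- (- frac (prodℕ u) (prodℕ v)))
    ≡⟨ cong (λ y → fromℕ y * (- (- frac (prodℕ u) (prodℕ v)))) prodℕ-t ⟩
  fromℕ (prodℕ u ℕ.* prodℕ v ℕ.* prodℕ x) * (- (- frac (prodℕ u) (prodℕ v)))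
    ≡⟨ fromℕ-*-frac (prodℕ u) (prodℕ v) (prodℕ x) 1≤v ⟩
  fromℕ (prodℕ u ℕ.* prodℕ u ℕ.* prodℕ x) ∎
  where
  open ≡-Reasoning
  t = (u ++ v) ++ x
  t≡ : t ≡ u ++ (v ++ x)
  t≡ = ListP.++-assoc u v x
  take-u : take (length u) t ≡ u
  take-u = trans (cong (take (length u)) t≡) (take-length-++ u (v ++ x))
  take-v : take (length v) (drop (length u) t) ≡ v
  take-v = trans (cong (take (length v) ∘ drop (length u)) t≡)
                 (trans (cong (take (length v)) (drop-length-++ u (v ++ x))) (take-length-++ v x))
  prodℕ-t : prodℕ t ≡ prodℕ u ℕ.* prodℕ v ℕ.* prodℕ x
  prodℕ-t = trans (prodℕ-++ (u ++ v) x) (cong (ℕ._* prodℕ x) (prodℕ-++ u v))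

m≤m*n*o : ∀ m {n o} → 1 ≤ n → 1 ≤ o → m ≤ m ℕ.* n ℕ.* o
m≤m*n*o m {n} {o} 1≤n 1≤o = ℕP.≤-trans (ℕP.m≤m*n m n ⦃ ℕ.>-nonZero 1≤n ⦄) (ℕP.m≤m*n (m ℕ.* n) o ⦃ ℕ.>-nonZero 1≤o ⦄)

n≤m*n*o : ∀ n {m o} → 1 ≤ m → 1 ≤ o → n ≤ m ℕ.* n ℕ.* o
n≤m*n*o n {m} {o} 1≤m 1≤o = ℕP.≤-trans (ℕP.m≤n*m n m ⦃ ℕ.>-nonZero 1≤m ⦄) (ℕP.m≤m*n (m ℕ.* n) o ⦃ ℕ.>-nonZero 1≤o ⦄)

o≤m*n*o : ∀ o {m n} → 1 ≤ m → 1 ≤ n → o ≤ m ℕ.* n ℕ.* o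
o≤m*n*o o {m} {n} 1≤m 1≤n = ℕP.m≤n*m o (m ℕ.* n) ⦃ ℕ.>-nonZero (ℕP.*-mono-≤ 1≤m 1≤n) ⦄

weightSum : ℕ → ℕ → ℕ → ℕ → ℕ → ℚ
weightSum i j k N n = ∑[ t ∈ tuples (i ℕ.+ j ℕ.+ k) N ] δ (prodℕ t) n (weight i j t)

-- u, v, x are the numerator, denominator and remaining blocks of a tuple (see weight-++).
blockSum : ℕ → ℕ → ℕ → ℕ → ℕ → ℚ
blockSum i j k N n =
  ∑[ u ∈ tuples i N ] ∑[ v ∈ tuples j N ] ∑[ x ∈ tuples k N ]
    δ (prodℕ u ℕ.* prodℕ v ℕ.* prodℕ x) n (fromℕ (prodℕ u ℕ.* prodℕ u ℕ.* prodℕ x))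

divisorSum : ℕ → ℕ → ℕ → ℕ → ℚ
divisorSum i j k n =
  ∑[ p ∈ range n ] fromℕ (τ i p) * (∑[ r ∈ range n ] fromℕ (τ j r) *
    (∑[ q ∈ range n ] fromℕ (τ k q) * δ (p ℕ.* r ℕ.* q) n (fromℕ (p ℕ.* p ℕ.* q))))

δ-vanishing : ∀ x n v → n < x → δ x n v ≡ 0ℚ
δ-vanishing x n v n<x = when-no (x ≟ n) v (λ { refl → ℕP.<-irrefl refl n<x })

weightSum≡blockSum : ∀ i j k N n → weightSum i j k N n ≡ blockSum i j k N n
weightSum≡blockSum i j k N n = begin
  weightSum i j k N n
    ≡⟨ Σl-tuples-+ (i ℕ.+ j) k N _ ⟩
  (∑[ uv ∈ tuples (i ℕ.+ j) N ] ∑[ x ∈ tuples k N ] δ (prodℕ (uv ++ x)) n (weight i j (uv ++ x)))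
    ≡⟨ Σl-tuples-+ i j N _ ⟩
  (∑[ u ∈ tuples i N ] ∑[ v ∈ tuples j N ] ∑[ x ∈ tuples k N ]
     δ (prodℕ ((u ++ v) ++ x)) n (weight i j ((u ++ v) ++ x)))
    ≡⟨ Σl-cong-All (tuples i N) (tuples-IsTuple i N) (λ u (len-u , _) →
       Σl-cong-All (tuples j N) (tuples-IsTuple j N) (λ v (len-v , 1≤v) → Σl-cong (tuples k N) (λ x →
         cong₂ (λ y → δ y n) (prodℕ-++³ u v x) (weight-++ i j u v x len-u len-v 1≤v)))) ⟩
  blockSum i j k N n ∎
  where
  open ≡-Reasoning
  prodℕ-++³ : ∀ u v x → prodℕ ((u ++ v) ++ x) ≡ prodℕ u ℕ.* prodℕ v ℕ.* prodℕ x
  prodℕ-++³ u v x = trans (prodℕ-++ (u ++ v) x) (cong (ℕ._* prodℕ x) (prodℕ-++ u v))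

blockSum≡divisorSum : ∀ i j k N n → n ≤ N → blockSum i j k N n ≡ divisorSum i j k n
blockSum≡divisorSum i j k N n n≤N = begin
  (∑[ u ∈ tuples i N ] G₁ (prodℕ u))
    ≡⟨ Σl-tuples-prodℕ i N n n≤N G₁ (λ y _ n<y → Σl-vanishing-All (tuples j N) (tuples-IsTuple j N) (λ v (_ , 1≤v) →
         Σl-vanishing-All (tuples k N) (tuples-IsTuple k N) (λ x (_ , 1≤x) →
           δ-vanishing _ n _ (ℕP.<-≤-trans n<y (m≤m*n*o y 1≤v 1≤x))))) ⟩
  (∑[ p ∈ range n ] fromℕ (τ i p) * G₁ p)
    ≡⟨ Σl-cong-All (range n) (range-bounds n) (λ p (1≤p , _) → cong (fromℕ (τ i p) *_) (begin
         G₁ p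
           ≡⟨ Σl-tuples-prodℕ j N n n≤N (G₂ p) (λ y _ n<y → Σl-vanishing-All (tuples k N) (tuples-IsTuple k N)
                (λ x (_ , 1≤x) → δ-vanishing _ n _ (ℕP.<-≤-trans n<y (n≤m*n*o y 1≤p 1≤x)))) ⟩
         (∑[ r ∈ range n ] fromℕ (τ j r) * G₂ p r)
           ≡⟨ Σl-cong-All (range n) (range-bounds n) (λ r (1≤r , _) → cong (fromℕ (τ j r) *_)
                (Σl-tuples-prodℕ k N n n≤N (G₃ p r) (λ y _ n<y →
                   δ-vanishing _ n _ (ℕP.<-≤-trans n<y (o≤m*n*o y 1≤p 1≤r))))) ⟩
         (∑[ r ∈ range n ] fromℕ (τ j r) * (∑[ q ∈ range n ] fromℕ (τ k q) * G₃ p r q)) ∎)) ⟩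
  divisorSum i j k n ∎
  where
  open ≡-Reasoning
  G₃ : ℕ → ℕ → ℕ → ℚ
  G₃ p r q = δ (p ℕ.* r ℕ.* q) n (fromℕ (p ℕ.* p ℕ.* q))
  G₂ : ℕ → ℕ → ℚ
  G₂ p r = ∑[ x ∈ tuples k N ] G₃ p r (prodℕ x)
  G₁ : ℕ → ℚ
  G₁ p = ∑[ v ∈ tuples j N ] G₂ p (prodℕ v)


-- The seven cases of χ

fromℕ-*-δ : ∀ a x n w → fromℕ a * δ x n (fromℕ w) ≡ δ x n (fromℕ (a ℕ.* w))
fromℕ-*-δ a x n w = trans (*-when (fromℕ a) _ (fromℕ w)) (cong (δ x n) (sym (fromℕ-* a w)))

-- τ₀ is the indicator of 1.
Σl-τ-zero : ∀ n → 1 ≤ n → (g : ℕ → ℚ) → Σl (range n) (λ r → fromℕ (τ 0 r) * g r) ≡ g 1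
Σl-τ-zero n 1≤n g = trans (Σl-range-single n 1 (s≤s z≤n) 1≤n _ τ₀g≡0) (ℚP.*-identityˡ (g 1))
  where
  τ₀g≡0 : ∀ p → p ≢ 1 → fromℕ (τ 0 p) * g p ≡ 0ℚ
  τ₀g≡0 p p≢1 = trans (cong (_* g p) (trans (length-filter≡Σl (λ t → prodℕ t ≟ p) ([] ∷ []))
    (trans (ℚP.+-identityʳ _) (when-no (1 ≟ p) 1ℚ (p≢1 ∘ sym))))) (ℚP.*-zeroˡ (g p))

module _ (n : ℕ) where

  Σ₁-fromℕ-δ : 1 ≤ n → (a x w : ℕ → ℕ) → (∀ p → x p ≡ p) →
    (∑[ p ∈ range n ] fromℕ (a p) * δ (x p) n (fromℕ (w p))) ≡ fromℕ (a n ℕ.* w n)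
  Σ₁-fromℕ-δ 1≤n a x w x≡ = trans
    (Σl-range-single n n 1≤n ℕP.≤-refl _ (λ p p≢n →
       trans (cong (fromℕ (a p) *_) (when-no (x p ≟ n) _ (λ xp≡n → p≢n (trans (sym (x≡ p)) xp≡n))))
             (ℚP.*-zeroʳ (fromℕ (a p)))))
    (trans (cong (fromℕ (a n) *_) (when-yes (x n ≟ n) _ (x≡ n))) (sym (fromℕ-* (a n) (w n))))

  Σ₂-fromℕ-δ : (a b : ℕ → ℕ) (x x′ w : ℕ → ℕ → ℕ) → (∀ p r → x p r ≡ x′ p r) →
    (∑[ p ∈ range n ] fromℕ (a p) * (∑[ r ∈ range n ] fromℕ (b r) * δ (x p r) n (fromℕ (w p r)))) ≡
    (∑[ p ∈ range n ] ∑[ r ∈ range n ] δ (x′ p r) n (fromℕ (a p ℕ.* (b r ℕ.* w p r))))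
  Σ₂-fromℕ-δ a b x x′ w x≡ = Σl-cong (range n) (λ p → trans (sym (Σl-*ˡ (range n) (fromℕ (a p)) _))
    (Σl-cong (range n) (λ r → begin
      fromℕ (a p) * (fromℕ (b r) * δ (x p r) n (fromℕ (w p r)))  ≡⟨ cong (fromℕ (a p) *_) (fromℕ-*-δ (b r) (x p r) n (w p r)) ⟩
      fromℕ (a p) * δ (x p r) n (fromℕ (b r ℕ.* w p r))          ≡⟨ fromℕ-*-δ (a p) (x p r) n (b r ℕ.* w p r) ⟩
      δ (x p r) n (fromℕ (a p ℕ.* (b r ℕ.* w p r)))              ≡⟨ cong (λ y → δ y n _) (x≡ p r) ⟩
      δ (x′ p r) n (fromℕ (a p ℕ.* (b r ℕ.* w p r)))             ∎)))
    where open ≡-Reasoning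

  Σ₃-fromℕ-δ : (a b c : ℕ → ℕ) (x x′ w : ℕ → ℕ → ℕ → ℕ) → (∀ p r q → x p r q ≡ x′ p r q) →
    (∑[ p ∈ range n ] fromℕ (a p) * (∑[ r ∈ range n ] fromℕ (b r) *
       (∑[ q ∈ range n ] fromℕ (c q) * δ (x p r q) n (fromℕ (w p r q))))) ≡
    (∑[ p ∈ range n ] ∑[ r ∈ range n ] ∑[ q ∈ range n ] δ (x′ p r q) n (fromℕ (a p ℕ.* (b r ℕ.* (c q ℕ.* w p r q)))))
  Σ₃-fromℕ-δ a b c x x′ w x≡ = Σl-cong (range n) (λ p → trans (sym (Σl-*ˡ (range n) (fromℕ (a p)) _))
    (Σl-cong (range n) (λ r → trans (cong (fromℕ (a p) *_) (sym (Σl-*ˡ (range n) (fromℕ (b r)) _)))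
      (trans (sym (Σl-*ˡ (range n) (fromℕ (a p)) _)) (Σl-cong (range n) (absorb p r))))))
    where
    open ≡-Reasoning
    absorb : ∀ p r q → fromℕ (a p) * (fromℕ (b r) * (fromℕ (c q) * δ (x p r q) n (fromℕ (w p r q)))) ≡
                       δ (x′ p r q) n (fromℕ (a p ℕ.* (b r ℕ.* (c q ℕ.* w p r q))))
    absorb p r q = begin
      fromℕ (a p) * (fromℕ (b r) * (fromℕ (c q) * δ (x p r q) n (fromℕ (w p r q))))
        ≡⟨ cong (λ v → fromℕ (a p) * (fromℕ (b r) * v)) (fromℕ-*-δ (c q) (x p r q) n (w p r q)) ⟩
      fromℕ (a p) * (fromℕ (b r) * δ (x p r q) n (fromℕ (c q ℕ.* w p r q)))
        ≡⟨ cong (fromℕ (a p) *_) (fromℕ-*-δ (b r) (x p r q) n _) ⟩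
      fromℕ (a p) * δ (x p r q) n (fromℕ (b r ℕ.* (c q ℕ.* w p r q)))
        ≡⟨ fromℕ-*-δ (a p) (x p r q) n _ ⟩
      δ (x p r q) n (fromℕ (a p ℕ.* (b r ℕ.* (c q ℕ.* w p r q))))
        ≡⟨ cong (λ y → δ y n _) (x≡ p r q) ⟩
      δ (x′ p r q) n (fromℕ (a p ℕ.* (b r ℕ.* (c q ℕ.* w p r q)))) ∎

  Σl-pairs : ∀ g → Σl (pairs n) g ≡ (∑[ a ∈ range n ] ∑[ b ∈ range n ] δ (a ℕ.* b) n (g (a , b)))
  Σl-pairs g = trans (Σl-filter _ (concatMap rows (range n)) g)
    (trans (Σl-concatMap (range n) rows _) (Σl-cong (range n) (λ a → Σl-map (range n) (a ,_) _)))
    where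
    rows : ℕ → List (ℕ × ℕ)
    rows a = map (a ,_) (range n)

  Σl-triples : ∀ g →
    Σl (triples n) g ≡ (∑[ a ∈ range n ] ∑[ b ∈ range n ] ∑[ c ∈ range n ] δ (a ℕ.* b ℕ.* c) n (g (a , b , c)))
  Σl-triples g = trans (Σl-filter _ (concatMap planes (range n)) g)
    (trans (Σl-concatMap (range n) planes _) (Σl-cong (range n) (λ a →
      trans (Σl-concatMap (range n) (rows a) _) (Σl-cong (range n) (λ b → Σl-map (range n) (λ c → (a , b , c)) _)))))
    where
    rows : ℕ → ℕ → List (ℕ × ℕ × ℕ)
    rows a b = map (λ c → (a , b , c)) (range n)
    planes : ℕ → List (ℕ × ℕ × ℕ)
    planes a = concatMap (rows a) (range n)

  fromℕ-*-sumℕ-pairs : ∀ c (f : ℕ × ℕ → ℕ) (g : ℕ → ℕ → ℕ) → (∀ a b → a ℕ.* b ≡ n → c ℕ.* f (a , b) ≡ g a b) →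
    fromℕ (c ℕ.* sumℕ (map f (pairs n))) ≡ (∑[ a ∈ range n ] ∑[ b ∈ range n ] δ (a ℕ.* b) n (fromℕ (g a b)))
  fromℕ-*-sumℕ-pairs c f g f≡g = begin
    fromℕ (c ℕ.* sumℕ (map f (pairs n)))
      ≡⟨ trans (fromℕ-* c _) (cong (fromℕ c *_) (trans (fromℕ-sumℕ (pairs n) f) (Σl-pairs (fromℕ ∘ f)))) ⟩
    fromℕ c * (∑[ a ∈ range n ] ∑[ b ∈ range n ] δ (a ℕ.* b) n (fromℕ (f (a , b))))
      ≡⟨ sym (Σl-*ˡ (range n) (fromℕ c) _) ⟩
    (∑[ a ∈ range n ] fromℕ c * (∑[ b ∈ range n ] δ (a ℕ.* b) n (fromℕ (f (a , b)))))
      ≡⟨ Σl-cong (range n) (λ a → trans (sym (Σl-*ˡ (range n) (fromℕ c) _)) (Σl-cong (range n) (λ b →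
           trans (fromℕ-*-δ c (a ℕ.* b) n (f (a , b))) (when-cong (a ℕ.* b ≟ n) (cong fromℕ ∘ f≡g a b))))) ⟩
    (∑[ a ∈ range n ] ∑[ b ∈ range n ] δ (a ℕ.* b) n (fromℕ (g a b))) ∎
    where open ≡-Reasoning

  fromℕ-sumℕ-pairs : ∀ (f : ℕ × ℕ → ℕ) (g : ℕ → ℕ → ℕ) → (∀ a b → f (a , b) ≡ g a b) →
    fromℕ (sumℕ (map f (pairs n))) ≡ (∑[ a ∈ range n ] ∑[ b ∈ range n ] δ (a ℕ.* b) n (fromℕ (g a b)))
  fromℕ-sumℕ-pairs f g f≡g = trans (cong fromℕ (sym (ℕP.*-identityˡ (sumℕ (map f (pairs n))))))
    (fromℕ-*-sumℕ-pairs 1 f g (λ a b _ → trans (ℕP.*-identityˡ (f (a , b))) (f≡g a b)))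

  fromℕ-sumℕ-triples : ∀ (f : ℕ × ℕ × ℕ → ℕ) (g : ℕ → ℕ → ℕ → ℕ) → (∀ a b c → f (a , b , c) ≡ g a b c) →
    fromℕ (sumℕ (map f (triples n))) ≡
    (∑[ a ∈ range n ] ∑[ b ∈ range n ] ∑[ c ∈ range n ] δ (a ℕ.* b ℕ.* c) n (fromℕ (g a b c)))
  fromℕ-sumℕ-triples f g f≡g = trans (fromℕ-sumℕ (triples n) f) (trans (Σl-triples (fromℕ ∘ f))
    (Σl-cong (range n) (λ a → Σl-cong (range n) (λ b → Σl-cong (range n) (λ c →
      cong (λ v → δ (a ℕ.* b ℕ.* c) n (fromℕ v)) (f≡g a b c))))))


divisorSum-i00 : ∀ i n → 1 ≤ n → divisorSum (suc i) 0 0 n ≡ fromℕ (χ (suc i) 0 0 n)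
divisorSum-i00 i n 1≤n = begin
  divisorSum (suc i) 0 0 n
    ≡⟨ Σl-cong (range n) (λ p → cong (fromℕ (τ (suc i) p) *_) (trans (Σl-τ-zero n 1≤n _) (Σl-τ-zero n 1≤n _))) ⟩
  (∑[ p ∈ range n ] fromℕ (τ (suc i) p) * δ (p ℕ.* 1 ℕ.* 1) n (fromℕ (p ℕ.* p ℕ.* 1)))
    ≡⟨ Σ₁-fromℕ-δ n 1≤n (τ (suc i)) (λ p → p ℕ.* 1 ℕ.* 1) (λ p → p ℕ.* p ℕ.* 1) solve-∀ ⟩
  fromℕ (τ (suc i) n ℕ.* (n ℕ.* n ℕ.* 1))
    ≡⟨ cong fromℕ (reorder (τ (suc i) n) n) ⟩
  fromℕ (n ℕ.* n ℕ.* τ (suc i) n) ∎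
  where
  open ≡-Reasoning
  reorder : ∀ t m → t ℕ.* (m ℕ.* m ℕ.* 1) ≡ m ℕ.* m ℕ.* t
  reorder = solve-∀

-- Here χ pulls the factor n = p q out of the weight p² q.
divisorSum-i0k : ∀ i k n → 1 ≤ n → divisorSum (suc i) 0 (suc k) n ≡ fromℕ (χ (suc i) 0 (suc k) n)
divisorSum-i0k i k n 1≤n = begin
  divisorSum (suc i) 0 (suc k) n
    ≡⟨ Σl-cong (range n) (λ p → cong (fromℕ (τ (suc i) p) *_) (Σl-τ-zero n 1≤n _)) ⟩
  (∑[ p ∈ range n ] fromℕ (τ (suc i) p) * (∑[ q ∈ range n ] fromℕ (τ (suc k) q) * δ (p ℕ.* 1 ℕ.* q) n (fromℕ (p ℕ.* p ℕ.* q))))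
    ≡⟨ Σ₂-fromℕ-δ n (τ (suc i)) (τ (suc k)) (λ p q → p ℕ.* 1 ℕ.* q) (λ p q → p ℕ.* q) (λ p q → p ℕ.* p ℕ.* q) solve-∀ ⟩
  (∑[ p ∈ range n ] ∑[ q ∈ range n ] δ (p ℕ.* q) n (fromℕ (τ (suc i) p ℕ.* (τ (suc k) q ℕ.* (p ℕ.* p ℕ.* q)))))
    ≡⟨ sym (fromℕ-*-sumℕ-pairs n n _ _ (λ p q pq≡n → trans (cong (ℕ._* _) (sym pq≡n))
         (reorder p q (τ (suc i) p) (τ (suc k) q)))) ⟩
  fromℕ (χ (suc i) 0 (suc k) n) ∎
  where
  open ≡-Reasoning
  reorder : ∀ p q s t → p ℕ.* q ℕ.* (p ℕ.* s ℕ.* t) ≡ s ℕ.* (t ℕ.* (p ℕ.* p ℕ.* q))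
  reorder = solve-∀

divisorSum-ij0 : ∀ i j n → 1 ≤ n → divisorSum (suc i) (suc j) 0 n ≡ fromℕ (χ (suc i) (suc j) 0 n)
divisorSum-ij0 i j n 1≤n = begin
  divisorSum (suc i) (suc j) 0 n
    ≡⟨ Σl-cong (range n) (λ p → cong (fromℕ (τ (suc i) p) *_) (Σl-cong (range n) (λ r →
         cong (fromℕ (τ (suc j) r) *_) (Σl-τ-zero n 1≤n _)))) ⟩
  (∑[ p ∈ range n ] fromℕ (τ (suc i) p) * (∑[ r ∈ range n ] fromℕ (τ (suc j) r) * δ (p ℕ.* r ℕ.* 1) n (fromℕ (p ℕ.* p ℕ.* 1))))
    ≡⟨ Σ₂-fromℕ-δ n (τ (suc i)) (τ (suc j)) (λ p r → p ℕ.* r ℕ.* 1) (λ p r → p ℕ.* r) (λ p r → p ℕ.* p ℕ.* 1) solve-∀ ⟩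
  (∑[ p ∈ range n ] ∑[ r ∈ range n ] δ (p ℕ.* r) n (fromℕ (τ (suc i) p ℕ.* (τ (suc j) r ℕ.* (p ℕ.* p ℕ.* 1)))))
    ≡⟨ sym (fromℕ-sumℕ-pairs n _ _ (λ p r → reorder p (τ (suc i) p) (τ (suc j) r))) ⟩
  fromℕ (χ (suc i) (suc j) 0 n) ∎
  where
  open ≡-Reasoning
  reorder : ∀ p s t → p ℕ.* p ℕ.* s ℕ.* t ≡ s ℕ.* (t ℕ.* (p ℕ.* p ℕ.* 1))
  reorder = solve-∀

divisorSum-ijk : ∀ i j k n → divisorSum (suc i) (suc j) (suc k) n ≡ fromℕ (χ (suc i) (suc j) (suc k) n)
divisorSum-ijk i j k n = begin
  divisorSum (suc i) (suc j) (suc k) n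
    ≡⟨ Σ₃-fromℕ-δ n (τ (suc i)) (τ (suc j)) (τ (suc k)) (λ p r q → p ℕ.* r ℕ.* q) (λ p r q → p ℕ.* q ℕ.* r)
               (λ p r q → p ℕ.* p ℕ.* q) solve-∀ ⟩
  (∑[ p ∈ range n ] ∑[ r ∈ range n ] ∑[ q ∈ range n ] δ (p ℕ.* q ℕ.* r) n (fromℕ (w p r q)))
    ≡⟨ Σl-cong (range n) (λ p → Σl-comm (range n) (range n) _) ⟩
  (∑[ p ∈ range n ] ∑[ q ∈ range n ] ∑[ r ∈ range n ] δ (p ℕ.* q ℕ.* r) n (fromℕ (w p r q)))
    ≡⟨ sym (fromℕ-sumℕ-triples n _ (λ p q r → w p r q) (λ p q r → reorder p q (τ (suc i) p) (τ (suc k) q) (τ (suc j) r))) ⟩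
  fromℕ (χ (suc i) (suc j) (suc k) n) ∎
  where
  open ≡-Reasoning
  reorder : ∀ p q s t u → p ℕ.* p ℕ.* q ℕ.* s ℕ.* t ℕ.* u ≡ s ℕ.* (u ℕ.* (t ℕ.* (p ℕ.* p ℕ.* q)))
  reorder = solve-∀
  w : ℕ → ℕ → ℕ → ℕ
  w p r q = τ (suc i) p ℕ.* (τ (suc j) r ℕ.* (τ (suc k) q ℕ.* (p ℕ.* p ℕ.* q)))

divisorSum-00k : ∀ k n → 1 ≤ n → divisorSum 0 0 (suc k) n ≡ fromℕ (χ 0 0 (suc k) n)
divisorSum-00k k n 1≤n = begin
  divisorSum 0 0 (suc k) n
    ≡⟨ trans (Σl-τ-zero n 1≤n _) (Σl-τ-zero n 1≤n _) ⟩
  (∑[ q ∈ range n ] fromℕ (τ (suc k) q) * δ (1 ℕ.* 1 ℕ.* q) n (fromℕ (1 ℕ.* 1 ℕ.* q)))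
    ≡⟨ Σ₁-fromℕ-δ n 1≤n (τ (suc k)) (λ q → 1 ℕ.* 1 ℕ.* q) (λ q → 1 ℕ.* 1 ℕ.* q) solve-∀ ⟩
  fromℕ (τ (suc k) n ℕ.* (1 ℕ.* 1 ℕ.* n))
    ≡⟨ cong fromℕ (reorder (τ (suc k) n) n) ⟩
  fromℕ (n ℕ.* τ (suc k) n) ∎
  where
  open ≡-Reasoning
  reorder : ∀ t m → t ℕ.* (1 ℕ.* 1 ℕ.* m) ≡ m ℕ.* t
  reorder = solve-∀

divisorSum-0jk : ∀ j k n → 1 ≤ n → divisorSum 0 (suc j) (suc k) n ≡ fromℕ (χ 0 (suc j) (suc k) n)
divisorSum-0jk j k n 1≤n = begin
  divisorSum 0 (suc j) (suc k) n
    ≡⟨ Σl-τ-zero n 1≤n _ ⟩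
  (∑[ r ∈ range n ] fromℕ (τ (suc j) r) * (∑[ q ∈ range n ] fromℕ (τ (suc k) q) * δ (1 ℕ.* r ℕ.* q) n (fromℕ (1 ℕ.* 1 ℕ.* q))))
    ≡⟨ Σ₂-fromℕ-δ n (τ (suc j)) (τ (suc k)) (λ r q → 1 ℕ.* r ℕ.* q) (λ r q → q ℕ.* r) (λ r q → 1 ℕ.* 1 ℕ.* q) solve-∀ ⟩
  (∑[ r ∈ range n ] ∑[ q ∈ range n ] δ (q ℕ.* r) n (fromℕ (w r q)))
    ≡⟨ Σl-comm (range n) (range n) _ ⟩
  (∑[ q ∈ range n ] ∑[ r ∈ range n ] δ (q ℕ.* r) n (fromℕ (w r q)))
    ≡⟨ sym (fromℕ-sumℕ-pairs n _ (λ q r → w r q) (λ q r → reorder q (τ (suc k) q) (τ (suc j) r))) ⟩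
  fromℕ (χ 0 (suc j) (suc k) n) ∎
  where
  open ≡-Reasoning
  reorder : ∀ q s t → q ℕ.* s ℕ.* t ≡ t ℕ.* (s ℕ.* (1 ℕ.* 1 ℕ.* q))
  reorder = solve-∀
  w : ℕ → ℕ → ℕ
  w r q = τ (suc j) r ℕ.* (τ (suc k) q ℕ.* (1 ℕ.* 1 ℕ.* q))

divisorSum-0j0 : ∀ j n → 1 ≤ n → divisorSum 0 (suc j) 0 n ≡ fromℕ (χ 0 (suc j) 0 n)
divisorSum-0j0 j n 1≤n = begin
  divisorSum 0 (suc j) 0 n
    ≡⟨ Σl-τ-zero n 1≤n _ ⟩
  (∑[ r ∈ range n ] fromℕ (τ (suc j) r) * (∑[ q ∈ range n ] fromℕ (τ 0 q) * δ (1 ℕ.* r ℕ.* q) n (fromℕ (1 ℕ.* 1 ℕ.* q))))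
    ≡⟨ Σl-cong (range n) (λ r → cong (fromℕ (τ (suc j) r) *_) (Σl-τ-zero n 1≤n _)) ⟩
  (∑[ r ∈ range n ] fromℕ (τ (suc j) r) * δ (1 ℕ.* r ℕ.* 1) n (fromℕ (1 ℕ.* 1 ℕ.* 1)))
    ≡⟨ Σ₁-fromℕ-δ n 1≤n (τ (suc j)) (λ r → 1 ℕ.* r ℕ.* 1) (λ _ → 1) solve-∀ ⟩
  fromℕ (τ (suc j) n ℕ.* 1)
    ≡⟨ cong fromℕ (ℕP.*-identityʳ (τ (suc j) n)) ⟩
  fromℕ (τ (suc j) n) ∎
  where open ≡-Reasoning

divisorSum≡χ : ∀ i j k n → 1 ≤ n → 1 ≤ i ℕ.+ j ℕ.+ k → divisorSum i j k n ≡ fromℕ (χ i j k n)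
divisorSum≡χ zero    zero    zero    n _   ()
divisorSum≡χ (suc i) zero    zero    n 1≤n _ = divisorSum-i00 i n 1≤n
divisorSum≡χ (suc i) zero    (suc k) n 1≤n _ = divisorSum-i0k i k n 1≤n
divisorSum≡χ (suc i) (suc j) zero    n 1≤n _ = divisorSum-ij0 i j n 1≤n
divisorSum≡χ (suc i) (suc j) (suc k) n _   _ = divisorSum-ijk i j k n
divisorSum≡χ zero    zero    (suc k) n 1≤n _ = divisorSum-00k k n 1≤n
divisorSum≡χ zero    (suc j) (suc k) n 1≤n _ = divisorSum-0jk j k n 1≤n
divisorSum≡χ zero    (suc j) zero    n 1≤n _ = divisorSum-0j0 j n 1≤n


-- Logarithmic derivatives of P and R

D-logS : ∀ n → D (logS n) ≗ multiplesS n 1ℚ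
D-logS n zero    = refl
D-logS n (suc M) with n ∣? suc M
... | yes _ = fromℕ*inv≡1 M
... | no  _ = ℚP.*-zeroʳ (fromℕ (suc M))

*-multiplesS : ∀ c m κ a → c * multiplesS m κ a ≡ multiplesS m (c * κ) a
*-multiplesS c m κ zero    = ℚP.*-zeroʳ c
*-multiplesS c m κ (suc a) = *-when c _ κ

Σl-multiplesS-prodℕ : ∀ N (ts : List (List ℕ)) → All (λ t → 1 ≤ prodℕ t) ts → (w : List ℕ → ℚ) → ∀ a →
  Σl (filter (λ t → prodℕ t ≤? N) ts) (λ t → multiplesS (prodℕ t) (w t) a) ≡
  Σl (range N) (λ n → multiplesS n (Σl ts (λ t → δ (prodℕ t) n (w t))) a)
Σl-multiplesS-prodℕ N ts 1≤ts w zero    = trans (Σl-zero (filter (λ t → prodℕ t ≤? N) ts)) (sym (Σl-zero (range N)))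
Σl-multiplesS-prodℕ N ts 1≤ts w (suc M) = begin
  Σl (filter (λ t → prodℕ t ≤? N) ts) (λ t → multiplesS (prodℕ t) (w t) (suc M))
    ≡⟨ Σl-filter (λ t → prodℕ t ≤? N) ts _ ⟩
  Σl ts (λ t → G t (prodℕ t))
    ≡⟨ Σl-cong-All ts 1≤ts (λ t 1≤t → expand-range N (prodℕ t) 1≤t (G t)
         (λ N<t → when-no (prodℕ t ≤? N) _ (ℕP.<⇒≱ N<t))) ⟩
  Σl ts (λ t → Σl (range N) (λ n → δ (prodℕ t) n (G t n)))
    ≡⟨ Σl-comm ts (range N) _ ⟩
  Σl (range N) (λ n → Σl ts (λ t → δ (prodℕ t) n (G t n)))
    ≡⟨ Σl-cong-All (range N) (range-bounds N) (λ n (_ , n≤N) → begin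
         Σl ts (λ t → δ (prodℕ t) n (G t n))
           ≡⟨ Σl-cong ts (λ t → when-cong (prodℕ t ≟ n) (λ _ → when-yes (n ≤? N) _ n≤N)) ⟩
         Σl ts (λ t → δ (prodℕ t) n (when (does (n ∣? suc M)) (w t)))
           ≡⟨ Σl-cong ts (λ t → when-when (does (prodℕ t ≟ n)) _ (w t)) ⟩
         Σl ts (λ t → when (does (n ∣? suc M)) (δ (prodℕ t) n (w t)))
           ≡⟨ Σl-when ts _ _ ⟩
         multiplesS n (Σl ts (λ t → δ (prodℕ t) n (w t))) (suc M) ∎) ⟩
  Σl (range N) (λ n → multiplesS n (Σl ts (λ t → δ (prodℕ t) n (w t))) (suc M)) ∎
  where
  open ≡-Reasoning
  G : List ℕ → ℕ → ℚ
  G t y = when (does (y ≤? N)) (when (does (y ∣? suc M)) (w t))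

boundedTuples : ℕ → ℕ → List (List ℕ)
boundedTuples a N = filter (λ t → prodℕ t ≤? N) (tuples a N)

1≤prodℕ-tuples : ∀ a N → All (λ t → 1 ≤ prodℕ t) (tuples a N)
1≤prodℕ-tuples a N = All.map (λ (_ , 1≤t) → 1≤t) (tuples-IsTuple a N)

1≤prodℕ-boundedTuples : ∀ a N → All (λ t → 1 ≤ prodℕ t) (boundedTuples a N)
1≤prodℕ-boundedTuples a N = AllP.filter⁺ (λ t → prodℕ t ≤? N) (1≤prodℕ-tuples a N)

-- P i j k N and R i j k N are the coefficients of z^N of these finite products.
productP : ℕ → ℕ → ℕ → ℕ → PS
productP i j k N = prodS (map (factorP i j) (boundedTuples (i ℕ.+ j ℕ.+ k) N))

productR : ℕ → ℕ → ℕ → ℕ → PS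
productR i j k N = prodS (map (λ n → powS (expS (logS n)) (χ i j k n)) (range N))

logDerivP : ℕ → ℕ → ℕ → ℕ → PS
logDerivP i j k N = ΣS (boundedTuples (i ℕ.+ j ℕ.+ k) N) (λ t → multiplesS (prodℕ t) (weight i j t))

logDerivR : ℕ → ℕ → ℕ → ℕ → PS
logDerivR i j k N = ΣS (range N) (λ n → fromℕ (χ i j k n) · D (logS n))

LogDeriv-productP : ∀ i j k N → LogDeriv (logDerivP i j k N) (productP i j k N)
LogDeriv-productP i j k N = LogDeriv-prodS (boundedTuples (i ℕ.+ j ℕ.+ k) N) (factorP i j) _
  (1≤prodℕ-boundedTuples (i ℕ.+ j ℕ.+ k) N) (λ t → LogDeriv-binomS (prodℕ t) (exponentP i j t))

LogDeriv-productR : ∀ i j k N → LogDeriv (logDerivR i j k N) (productR i j k N)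
LogDeriv-productR i j k N = LogDeriv-prodS (range N) _ _ (range-bounds N)
  (λ n _ → LogDeriv-powS (χ i j k n) (LogDeriv-expS (logS n) refl))

productP-0 : ∀ i j k N → productP i j k N 0 ≡ 1ℚ
productP-0 i j k N = prodS-0 (boundedTuples (i ℕ.+ j ℕ.+ k) N) (factorP i j) (1≤prodℕ-boundedTuples (i ℕ.+ j ℕ.+ k) N)
  (λ t _ → binomS-0 (prodℕ t) (exponentP i j t))

productR-0 : ∀ i j k N → productR i j k N 0 ≡ 1ℚ
productR-0 i j k N = prodS-0 (range N) _ (range-bounds N) (λ n _ → powS-0 (expS (logS n)) (χ i j k n) refl)

logDerivP≗logDerivR : ∀ i j k → 1 ≤ i ℕ.+ j ℕ.+ k → ∀ N → logDerivP i j k N ≗ logDerivR i j k N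
logDerivP≗logDerivR i j k ijk N a = begin
  logDerivP i j k N a
    ≡⟨ Σl-multiplesS-prodℕ N (tuples (i ℕ.+ j ℕ.+ k) N) (1≤prodℕ-tuples (i ℕ.+ j ℕ.+ k) N) (weight i j) a ⟩
  (∑[ n ∈ range N ] multiplesS n (weightSum i j k N n) a)
    ≡⟨ Σl-cong-All (range N) (range-bounds N) (λ n (1≤n , n≤N) → cong (λ κ → multiplesS n κ a) (begin
         weightSum i j k N n    ≡⟨ weightSum≡blockSum i j k N n ⟩
         blockSum i j k N n     ≡⟨ blockSum≡divisorSum i j k N n n≤N ⟩
         divisorSum i j k n     ≡⟨ divisorSum≡χ i j k n 1≤n ijk ⟩
         fromℕ (χ i j k n)      ∎)) ⟩
  (∑[ n ∈ range N ] multiplesS n (fromℕ (χ i j k n)) a)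
    ≡⟨ Σl-cong (range N) (λ n → sym (begin
         fromℕ (χ i j k n) * D (logS n) a          ≡⟨ cong (fromℕ (χ i j k n) *_) (D-logS n a) ⟩
         fromℕ (χ i j k n) * multiplesS n 1ℚ a     ≡⟨ *-multiplesS (fromℕ (χ i j k n)) n 1ℚ a ⟩
         multiplesS n (fromℕ (χ i j k n) * 1ℚ) a   ≡⟨ cong (λ κ → multiplesS n κ a) (ℚP.*-identityʳ _) ⟩
         multiplesS n (fromℕ (χ i j k n)) a        ∎)) ⟩
  logDerivR i j k N a ∎
  where open ≡-Reasoning

theorem3p2 : (i j k : ℕ) → 1 ≤ i ℕ.+ j ℕ.+ k → (N : ℕ) → P i j k N ≡ R i j k N
theorem3p2 i j k ijk N =
  LogDeriv-unique-≤ N (trans (productP-0 i j k N) (sym (productR-0 i j k N)))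
    (Σl-zero (boundedTuples (i ℕ.+ j ℕ.+ k) N))
    (λ a _ → logDerivP≗logDerivR i j k ijk N a)
    (LogDeriv-productP i j k N) (LogDeriv-productR i j k N)
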